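{- Let $n \in \mathbb{N}$ and let $n_1$ be the integer with $2^{n_1}\le n<2^{n_1+1}$. Then $$D_n^{*}(Y^{\mathrm{vdC}}) = \frac{1}{2^{n_1+1}} \sum_{m=0}^{2^{n_1+1}-1} \left| \frac{1}{n}\sum_{k=0}^{n-1} \mathrm{wal}_{m}(y_k) \right|.$$
   Context: Walsh functions: for a nonnegative integer $k$ with binary representation $k=k_0+k_1 2+\cdots+k_m 2^m$, the function $\mathrm{wal}_k:\mathbb{R}\to\mathbb{R}$ is $1$-periodic and defined for $x\in[0,1)$ with canonical binary expansion $x=\frac{x_1}{2}+\frac{x_2}{2^2}+\cdots$ (not ending in infinitely many $1$'s) by $\mathrm{wal}_k(x)=(-1)^{x_1k_0+x_2k_1+\cdots+x_{m+1}k_m}$. Van der Corput sequence $Y^{\mathrm{vdC}}=(y_k)_{k\ge0}$: if $k=k_0+k_1 2+k_2 2^2+\cdots$ in binary, then $y_k=\frac{k_0}{2}+\frac{k_1}{2^2}+\frac{k_2}{2^3}+\cdots$. For a sequence $X=(x_k)_{k\ge0}$ in $[0,1)$, $D_n^*(X)=\sup_{t\in[0,1]}\left|\frac{\#\{0\le k<n: x_k\in[0,t)\}}{n}-t\right|$.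
   Formalization: The variable t in the supremum defining $D_n^*(X)$ ranges over rational values in [0,1], and the Walsh functions $\mathrm{wal}_k$ are defined on ℚ rather than on ℝ. -}

module Defs where

open import Data.Nat as ℕ using (ℕ; zero; suc; _^_; NonZero)
open import Data.Integer as ℤ using (ℤ; +_; _%ℕ_)
open import Data.Rational as ℚ using (ℚ; floor; ∣_∣; _<?_; _≤_; _<_; 0ℚ; 1ℚ)
open import Data.Product using (_×_; ∃-syntax)
open import Relation.Nullary.Decidable using (does)
open import Data.Bool using (if_then_else_)
open import Data.Nat.Properties using (m^n>0)

sumℕ : ℕ → (ℕ → ℕ) → ℕ
sumℕ zero    f = 0
sumℕ (suc n) f = sumℕ n f ℕ.+ f n

sumℤ : ℕ → (ℕ → ℤ) → ℤ
sumℤ zero    f = + 0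
sumℤ (suc n) f = sumℤ n f ℤ.+ f n

sumℚ : ℕ → (ℕ → ℚ) → ℚ
sumℚ zero    f = 0ℚ
sumℚ (suc n) f = sumℚ n f ℚ.+ f n

bit : ℕ → ℕ → ℕ
bit i k = (ℕ._/_ k (2 ^ i) {{ℕ.>-nonZero (m^n>0 2 i)}}) ℕ.% 2

-- j-th binary digit (j ≥ 1) of the canonical expansion of frac(x):
-- x_j = ⌊2^j x⌋ mod 2  (this is automatically 1-periodic in x)
digit : ℕ → ℚ → ℕ
digit j x = floor ((+ (2 ^ j) ℚ./ 1) ℚ.* x) %ℕ 2

signPow : ℕ → ℤ
signPow e = if does (e ℕ.% 2 ℕ.≟ 0) then + 1 else ℤ.- (+ 1)

-- Walsh function wal_m(x) = (-1)^(x_1 m_0 + x_2 m_1 + ...);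
-- m has fewer than m+1 binary digits, so summing over i < m+1 suffices.
wal : ℕ → ℚ → ℤ
wal m x = signPow (sumℕ (suc m) (λ i → bit i m ℕ.* digit (suc i) x))

vdC : ℕ → ℚ
vdC k = sumℚ (suc k) (λ i → ℚ._/_ (+ bit i k) (2 ^ suc i) {{ℕ.>-nonZero (m^n>0 2 (suc i))}})

count : (ℕ → ℚ) → ℕ → ℚ → ℕ
count X n t = sumℕ n (λ k → if does (X k <? t) then 1 else 0)

localDisc : (X : ℕ → ℚ) (n : ℕ) .{{_ : NonZero n}} → ℚ → ℚ
localDisc X n t = ∣ (+ count X n t) ℚ./ n ℚ.- t ∣

-- "D_n^*(X) = d": d is the supremum of localDisc over t ∈ [0,1]
-- (over rational t)
StarDiscrepancyIs : (X : ℕ → ℚ) (n : ℕ) .{{_ : NonZero n}} → ℚ → Set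
StarDiscrepancyIs X n d =
  (∀ t → 0ℚ ≤ t → t ≤ 1ℚ → localDisc X n t ≤ d) ×
  (∀ ε → 0ℚ < ε → ∃[ t ] (0ℚ ≤ t × t ≤ 1ℚ × d ℚ.- ε < localDisc X n t))

walshRHS : (n n1 : ℕ) .{{_ : NonZero n}} → ℚ
walshRHS n n1 =
  (ℚ._/_ (+ 1) (2 ^ suc n1) {{ℕ.>-nonZero (m^n>0 2 (suc n1))}}) ℚ.*
  sumℚ (2 ^ suc n1) (λ m → ∣ sumℤ n (λ k → wal m (vdC k)) ℚ./ n ∣)

-- Write y_k for the van der Corput sequence and E(n, t) = #{k < n : y_k < t} − n t.  Because
-- y_{2k} = y_k / 2 < ½ ≤ (1 + y_k) / 2 = y_{2k+1}, the first n = b + 2h points (b ≤ 1) are the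
-- first b + h points squeezed into [0, ½) followed by the first h points squeezed into [½, 1).
-- Rescaling t to s = 2t or s = 2t − 1 gives 2 E(b + 2h, t) = E(h, s) + E(b + h, s) + b w with
-- 0 ≤ w ≤ 1, so by induction on L, 0 ≤ 2^L E(n, t) ≤ Δ L n whenever n ≤ 2^L.  Counting the closed
-- interval [0, t] instead, w = 1 at t = y_{⌊n/2⌋}, where the bound is attained; hence
-- D_n^* = Δ L n / (2^L n), approached from the right of y_{⌊n/2⌋}.
-- The binary digits of y_k are those of k, so wal_m(y_k) = (−1)^(Σ m_i k_i), and the same split
-- of m and k gives S_{2m}(n) = x + y and S_{2m+1}(n) = x − y for S_m(n) = Σ_{k<n} wal_m(y_k),
-- x = S_m(b + h) and y = S_m(h).  Since x − y = b · wal_m(y_h), x and y are equal or adjacent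
-- integers and |x + y| + |x − y| = |x| + |y| + b; so Σ_{m<2^L} |S_m(n)| obeys the recursion of Δ.

module Submission where

open import Defs
open import Data.Nat using (ℕ; suc; _^_; _≤_; _<_; NonZero)
open import Data.Nat as ℕ using (zero; _+_; _*_; _/_; _%_; z≤n; s≤s)
import Data.Nat.Properties as ℕₚ
import Data.Nat.DivMod as ℕ
import Data.Nat.Coprimality as Coprimality
open import Data.Nat.Divisibility using (m∣m*n)
open import Data.Nat.Induction using (<-rec)
open import Data.Integer as ℤ using (ℤ; +_; -[1+_])
import Data.Integer.Properties as ℤₚ
import Data.Integer.DivMod as ℤ
import Data.Integer.Tactic.RingSolver as ℤ-Solver
open import Data.Rational as ℚ using (ℚ; mkℚ; 0ℚ; 1ℚ; ½; floor)
import Data.Rational.Properties as ℚₚ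
open import Data.Bool using (if_then_else_)
open import Data.Empty using (⊥-elim)
open import Data.Product using (_×_; _,_; proj₁; proj₂; ∃-syntax)
open import Data.Sum using (inj₁; inj₂)
open import Function using (_∘_; _⇔_; mk⇔)
open import Level using (0ℓ)
open import Algebra.Bundles using (CommutativeSemigroup)
open import Algebra.Structures using (IsCommutativeMonoid)
open import Relation.Nullary using (Dec; yes; no; ¬_)
open import Relation.Nullary.Decidable using (does; dec-true; dec-false; does-⇔; dec⇒maybe)
open import Relation.Binary using (Decidable)
open import Relation.Binary.PropositionalEquality
  using (_≡_; refl; sym; trans; cong; cong₂; subst; subst₂; module ≡-Reasoning)
open import Tactic.RingSolver using (solve-∀)
import Tactic.RingSolver.Core.AlmostCommutativeRing as ACR


-- The zero test lets the solver cancel constant coefficients such as 2 · ½ − 1.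
ℚ-ring : ACR.AlmostCommutativeRing 0ℓ 0ℓ
ℚ-ring = ACR.fromCommutativeRing ℚₚ.+-*-commutativeRing (λ q → dec⇒maybe (0ℚ ℚₚ.≟ q))

fromℤ : ℤ → ℚ
fromℤ z = z ℚ./ 1

fromℕ : ℕ → ℚ
fromℕ n = fromℤ (+ n)

recip : (d : ℕ) .{{_ : NonZero d}} → ℚ
recip d = + 1 ℚ./ d

fromℤ-mkℚ : ∀ z → fromℤ z ≡ mkℚ z 0 (Coprimality.sym (Coprimality.1-coprimeTo ℤ.∣ z ∣))
fromℤ-mkℚ (+ n)    = ℚₚ.normalize-coprime {n} _
fromℤ-mkℚ -[1+ n ] = cong ℚ.-_ (ℚₚ.normalize-coprime {suc n} _)

recip-mkℚ : ∀ d .{{_ : NonZero d}} → recip d ≡ mkℚ (+ 1) (ℕ.pred d) (Coprimality.1-coprimeTo _)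
recip-mkℚ (suc d) = ℚₚ.normalize-coprime {1} {d} _

fromℤ-+ : ∀ a b → fromℤ (a ℤ.+ b) ≡ fromℤ a ℚ.+ fromℤ b
fromℤ-+ a b = begin
  fromℤ (a ℤ.+ b)                         ≡⟨ cong fromℤ (sym (cong₂ ℤ._+_ (ℤₚ.*-identityʳ a) (ℤₚ.*-identityʳ b))) ⟩
  fromℤ (a ℤ.* + 1 ℤ.+ b ℤ.* + 1)         ≡⟨ sym (cong₂ ℚ._+_ (fromℤ-mkℚ a) (fromℤ-mkℚ b)) ⟩
  fromℤ a ℚ.+ fromℤ b                     ∎
  where open ≡-Reasoning

fromℤ-* : ∀ a b → fromℤ (a ℤ.* b) ≡ fromℤ a ℚ.* fromℤ b
fromℤ-* a b = sym (cong₂ ℚ._*_ (fromℤ-mkℚ a) (fromℤ-mkℚ b))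

fromℕ-+ : ∀ m n → fromℕ (m + n) ≡ fromℕ m ℚ.+ fromℕ n
fromℕ-+ m n = fromℤ-+ (+ m) (+ n)

fromℕ-* : ∀ m n → fromℕ (m * n) ≡ fromℕ m ℚ.* fromℕ n
fromℕ-* m n = trans (cong fromℤ (ℤₚ.pos-* m n)) (fromℤ-* (+ m) (+ n))

fromℤ-mono-≤ : ∀ {a b} → a ℤ.≤ b → fromℤ a ℚ.≤ fromℤ b
fromℤ-mono-≤ {a} {b} a≤b rewrite fromℤ-mkℚ a | fromℤ-mkℚ b =
  ℚ.*≤* (subst₂ ℤ._≤_ (sym (ℤₚ.*-identityʳ a)) (sym (ℤₚ.*-identityʳ b)) a≤b)

fromℤ-cancel-< : ∀ {a b} → fromℤ a ℚ.< fromℤ b → a ℤ.< b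
fromℤ-cancel-< {a} {b} fa<fb rewrite fromℤ-mkℚ a | fromℤ-mkℚ b with fa<fb
... | ℚ.*<* a<b = subst₂ ℤ._<_ (ℤₚ.*-identityʳ a) (ℤₚ.*-identityʳ b) a<b

fromℕ-mono-≤ : ∀ {m n} → m ≤ n → fromℕ m ℚ.≤ fromℕ n
fromℕ-mono-≤ m≤n = fromℤ-mono-≤ (ℤ.+≤+ m≤n)

0≤fromℕ : ∀ n → 0ℚ ℚ.≤ fromℕ n
0≤fromℕ n = fromℕ-mono-≤ {0} {n} z≤n

∣fromℤ∣ : ∀ z → ℚ.∣ fromℤ z ∣ ≡ fromℕ ℤ.∣ z ∣
∣fromℤ∣ z = trans (cong ℚ.∣_∣ (fromℤ-mkℚ z)) (sym (fromℤ-mkℚ (+ ℤ.∣ z ∣)))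

/≡*recip : ∀ z d .{{_ : NonZero d}} → z ℚ./ d ≡ fromℤ z ℚ.* recip d
/≡*recip z d@(suc _) = begin
  z ℚ./ d                           ≡⟨ ℚₚ./-cong (sym (ℤₚ.*-identityʳ z)) (sym (ℕₚ.*-identityˡ d)) ⟩
  (z ℤ.* + 1) ℚ./ (1 * d)           ≡⟨ sym (cong₂ ℚ._*_ (fromℤ-mkℚ z) (recip-mkℚ d)) ⟩
  fromℤ z ℚ.* recip d               ∎
  where open ≡-Reasoning

fromℕ*recip≡1 : ∀ d .{{_ : NonZero d}} → fromℕ d ℚ.* recip d ≡ 1ℚ
fromℕ*recip≡1 d@(suc _) =
  trans (cong₂ ℚ._*_ (fromℤ-mkℚ (+ d)) (recip-mkℚ d)) (ℚₚ.*-inverseʳ (mkℚ (+ d) 0 (Coprimality.sym (Coprimality.1-coprimeTo d))))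

recip*[fromℕ*x]≡x : ∀ d .{{_ : NonZero d}} x → recip d ℚ.* (fromℕ d ℚ.* x) ≡ x
recip*[fromℕ*x]≡x d x = begin
  recip d ℚ.* (fromℕ d ℚ.* x)   ≡⟨ ℚₚ.*-assoc (recip d) (fromℕ d) x ⟨
  recip d ℚ.* fromℕ d ℚ.* x     ≡⟨ cong (ℚ._* x) (trans (ℚₚ.*-comm (recip d) (fromℕ d)) (fromℕ*recip≡1 d)) ⟩
  1ℚ ℚ.* x                      ≡⟨ ℚₚ.*-identityˡ x ⟩
  x                             ∎
  where open ≡-Reasoning

0<recip : ∀ d .{{_ : NonZero d}} → 0ℚ ℚ.< recip d
0<recip d@(suc _) = ℚₚ.positive⁻¹ (recip d) {{ℚₚ.normalize-pos 1 d}}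

recip-* : ∀ m n .{{_ : NonZero m}} .{{_ : NonZero n}} →
          recip (m * n) {{ℕₚ.m*n≢0 m n}} ≡ recip m ℚ.* recip n
recip-* m@(suc _) n@(suc _) = sym (cong₂ ℚ._*_ (recip-mkℚ m) (recip-mkℚ n))

∣z/n∣≡∣z∣*recip : ∀ z n .{{_ : NonZero n}} → ℚ.∣ z ℚ./ n ∣ ≡ fromℕ ℤ.∣ z ∣ ℚ.* recip n
∣z/n∣≡∣z∣*recip z n = begin
  ℚ.∣ z ℚ./ n ∣                 ≡⟨ cong ℚ.∣_∣ (/≡*recip z n) ⟩
  ℚ.∣ fromℤ z ℚ.* recip n ∣     ≡⟨ ℚₚ.∣p*q∣≡∣p∣*∣q∣ (fromℤ z) (recip n) ⟩
  ℚ.∣ fromℤ z ∣ ℚ.* ℚ.∣ recip n ∣ ≡⟨ cong₂ ℚ._*_ (∣fromℤ∣ z) (ℚₚ.0≤p⇒∣p∣≡p (ℚₚ.<⇒≤ (0<recip n))) ⟩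
  fromℕ ℤ.∣ z ∣ ℚ.* recip n     ∎
  where open ≡-Reasoning

floor-mkℚ : ∀ n d .(c : Coprimality.Coprime ℤ.∣ n ∣ (suc d)) → floor (mkℚ n d c) ≡ n ℤ./ℕ suc d
floor-mkℚ n d c = ℤₚ.*-identityˡ (n ℤ./ℕ suc d)

floor-lower : ∀ q → fromℤ (floor q) ℚ.≤ q
floor-lower (mkℚ n d c) rewrite floor-mkℚ n d c | fromℤ-mkℚ (n ℤ./ℕ suc d) =
  ℚ.*≤* (subst (λ x → (n ℤ./ℕ suc d) ℤ.* + suc d ℤ.≤ x) (sym (ℤₚ.*-identityʳ n)) (ℤ.[n/ℕd]*d≤n n (suc d)))

floor-upper : ∀ q → q ℚ.< fromℤ (ℤ.suc (floor q))
floor-upper (mkℚ n d c) rewrite floor-mkℚ n d c | fromℤ-mkℚ (ℤ.suc (n ℤ./ℕ suc d)) =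
  ℚ.*<* (subst (λ x → x ℤ.< ℤ.suc (n ℤ./ℕ suc d) ℤ.* + suc d) (sym (ℤₚ.*-identityʳ n)) (ℤ.n<s[n/ℕd]*d n (suc d)))

private
  <suc⇒≤ : ∀ {i j} → i ℤ.< ℤ.suc j → i ℤ.≤ j
  <suc⇒≤ {i} {j} i<j+1 = subst₂ ℤ._≤_ (ℤₚ.pred-suc i) (ℤₚ.pred-suc j) (ℤₚ.pred-mono (ℤₚ.i<j⇒suc[i]≤j i<j+1))

floor-unique : ∀ z q → fromℤ z ℚ.≤ q → q ℚ.< fromℤ (ℤ.suc z) → floor q ≡ z
floor-unique z q z≤q q<z+1 = ℤₚ.≤-antisym
  (<suc⇒≤ (fromℤ-cancel-< (ℚₚ.≤-<-trans (floor-lower q) q<z+1)))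
  (<suc⇒≤ (fromℤ-cancel-< (ℚₚ.≤-<-trans z≤q (floor-upper q))))

floor-nonNeg : ∀ q → 0ℚ ℚ.≤ q → floor q ≡ + ℤ.∣ floor q ∣
floor-nonNeg q 0≤q = sym (ℤₚ.0≤i⇒+∣i∣≡i (<suc⇒≤ (fromℤ-cancel-< (ℚₚ.≤-<-trans 0≤q (floor-upper q)))))

floor-fromℤ-+ : ∀ m q → floor (fromℤ m ℚ.+ q) ≡ m ℤ.+ floor q
floor-fromℤ-+ m q = floor-unique (m ℤ.+ floor q) (fromℤ m ℚ.+ q)
  (subst (ℚ._≤ fromℤ m ℚ.+ q) (sym (fromℤ-+ m (floor q))) (ℚₚ.+-monoʳ-≤ (fromℤ m) (floor-lower q)))
  (subst (fromℤ m ℚ.+ q ℚ.<_) m+[q+1] (ℚₚ.+-monoʳ-< (fromℤ m) (floor-upper q)))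
  where
  m+[q+1] : fromℤ m ℚ.+ fromℤ (ℤ.suc (floor q)) ≡ fromℤ (ℤ.suc (m ℤ.+ floor q))
  m+[q+1] = trans (sym (fromℤ-+ m _)) (cong fromℤ (begin
    m ℤ.+ (+ 1 ℤ.+ floor q)   ≡⟨ sym (ℤₚ.+-assoc m (+ 1) (floor q)) ⟩
    m ℤ.+ + 1 ℤ.+ floor q     ≡⟨ cong (ℤ._+ floor q) (ℤₚ.+-comm m (+ 1)) ⟩
    + 1 ℤ.+ m ℤ.+ floor q     ≡⟨ ℤₚ.+-assoc (+ 1) m (floor q) ⟩
    + 1 ℤ.+ (m ℤ.+ floor q)   ∎))
    where open ≡-Reasoning

0≤p*q : ∀ {p q} → 0ℚ ℚ.≤ p → 0ℚ ℚ.≤ q → 0ℚ ℚ.≤ p ℚ.* q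
0≤p*q {p} {q} 0≤p 0≤q = ℚₚ.nonNegative⁻¹ (p ℚ.* q)
  {{ℚₚ.nonNeg*nonNeg⇒nonNeg p {{ℚ.nonNegative 0≤p}} q {{ℚ.nonNegative 0≤q}}}}

*-monoˡ-≤ : ∀ {r p q} → 0ℚ ℚ.≤ r → p ℚ.≤ q → r ℚ.* p ℚ.≤ r ℚ.* q
*-monoˡ-≤ {r} 0≤r = ℚₚ.*-monoˡ-≤-nonNeg r {{ℚ.nonNegative 0≤r}}

*-monoʳ-≤ : ∀ {r p q} → 0ℚ ℚ.≤ r → p ℚ.≤ q → p ℚ.* r ℚ.≤ q ℚ.* r
*-monoʳ-≤ {r} 0≤r = ℚₚ.*-monoʳ-≤-nonNeg r {{ℚ.nonNegative 0≤r}}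

p≤q⇒0≤q-p : ∀ {p q} → p ℚ.≤ q → 0ℚ ℚ.≤ q ℚ.- p
p≤q⇒0≤q-p {p} {q} p≤q = subst (ℚ._≤ q ℚ.- p) (ℚₚ.+-inverseʳ p) (ℚₚ.+-monoˡ-≤ (ℚ.- p) p≤q)

0≤q⇒p-q≤p : ∀ {p q} → 0ℚ ℚ.≤ q → p ℚ.- q ℚ.≤ p
0≤q⇒p-q≤p {p} {q} 0≤q = subst (p ℚ.- q ℚ.≤_) (ℚₚ.+-identityʳ p) (ℚₚ.+-monoʳ-≤ p (ℚₚ.neg-antimono-≤ 0≤q))

≤⇒≮ : ∀ {x y} → y ℚ.≤ x → ¬ (x ℚ.< y)
≤⇒≮ y≤x x<y = ℚₚ.<-irrefl refl (ℚₚ.<-≤-trans x<y y≤x)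

<⇒≱ : ∀ {x y} → y ℚ.< x → ¬ (x ℚ.≤ y)
<⇒≱ y<x x≤y = ℚₚ.<-irrefl refl (ℚₚ.<-≤-trans y<x x≤y)

<-affine : ∀ c d {x y} → 0ℚ ℚ.< c → x ℚ.< y → c ℚ.* x ℚ.+ d ℚ.< c ℚ.* y ℚ.+ d
<-affine c d 0<c x<y = ℚₚ.+-monoˡ-< d (ℚₚ.*-monoʳ-<-pos c {{ℚ.positive 0<c}} x<y)

≤-affine : ∀ c d {x y} → 0ℚ ℚ.< c → x ℚ.≤ y → c ℚ.* x ℚ.+ d ℚ.≤ c ℚ.* y ℚ.+ d
≤-affine c d 0<c x≤y = ℚₚ.+-monoˡ-≤ d (*-monoˡ-≤ (ℚₚ.<⇒≤ 0<c) x≤y)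

½*x<x : ∀ x → 0ℚ ℚ.< x → ½ ℚ.* x ℚ.< x
½*x<x x 0<x = begin-strict
  ½ ℚ.* x                  ≡⟨ ℚₚ.+-identityʳ (½ ℚ.* x) ⟨
  ½ ℚ.* x ℚ.+ 0ℚ           <⟨ ℚₚ.+-monoʳ-< (½ ℚ.* x) (ℚₚ.*-monoʳ-<-pos ½ 0<x) ⟩
  ½ ℚ.* x ℚ.+ ½ ℚ.* x      ≡⟨ halves x ⟩
  x                        ∎
  where
  open ℚₚ.≤-Reasoning
  halves : ∀ x → ½ ℚ.* x ℚ.+ ½ ℚ.* x ≡ x
  halves = solve-∀ ℚ-ring

room-below-1 : ∀ ε t → 0ℚ ℚ.< ε → t ℚ.< 1ℚ → ∃[ δ ] (0ℚ ℚ.< δ × δ ℚ.< ε × t ℚ.+ δ ℚ.≤ 1ℚ)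
room-below-1 ε t 0<ε t<1 = ½ ℚ.* m , ℚₚ.*-monoʳ-<-pos ½ 0<m , ℚₚ.<-≤-trans (½*x<x m 0<m) (ℚₚ.p⊓q≤p ε (1ℚ ℚ.- t)) , t+δ≤1
  where
  m : ℚ
  m = ε ℚ.⊓ (1ℚ ℚ.- t)
  0<1-t : 0ℚ ℚ.< 1ℚ ℚ.- t
  0<1-t = subst (ℚ._< 1ℚ ℚ.- t) (ℚₚ.+-inverseʳ t) (ℚₚ.+-monoˡ-< (ℚ.- t) t<1)
  0<m : 0ℚ ℚ.< m
  0<m with ℚₚ.⊓-sel ε (1ℚ ℚ.- t)
  ... | inj₁ m≡ε   = subst (0ℚ ℚ.<_) (sym m≡ε) 0<ε
  ... | inj₂ m≡1-t = subst (0ℚ ℚ.<_) (sym m≡1-t) 0<1-t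
  t+δ≤1 : t ℚ.+ ½ ℚ.* m ℚ.≤ 1ℚ
  t+δ≤1 = begin
    t ℚ.+ ½ ℚ.* m         ≤⟨ ℚₚ.+-monoʳ-≤ t (ℚₚ.≤-trans (ℚₚ.<⇒≤ (½*x<x m 0<m)) (ℚₚ.p⊓q≤q ε (1ℚ ℚ.- t))) ⟩
    t ℚ.+ (1ℚ ℚ.- t)      ≡⟨ cancel t ⟩
    1ℚ                    ∎
    where
    open ℚₚ.≤-Reasoning
    cancel : ∀ t → t ℚ.+ (1ℚ ℚ.- t) ≡ 1ℚ
    cancel = solve-∀ ℚ-ring

module FiniteSum {A : Set} {_∙_ : A → A → A} {ε : A} (isCM : IsCommutativeMonoid _≡_ _∙_ ε)
  (∑ : ℕ → (ℕ → A) → A) (∑-zero : ∀ f → ∑ 0 f ≡ ε) (∑-suc : ∀ n f → ∑ (suc n) f ≡ ∑ n f ∙ f n) where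

  open IsCommutativeMonoid isCM using (assoc; comm; identityˡ; identityʳ; isCommutativeSemigroup)
  open ≡-Reasoning

  ∙-semigroup : CommutativeSemigroup 0ℓ 0ℓ
  ∙-semigroup = record { isCommutativeSemigroup = isCommutativeSemigroup }

  open import Algebra.Properties.CommutativeSemigroup ∙-semigroup using (interchange; xy∙z≈xz∙y)

  ∑-cong : ∀ n {f g} → (∀ i → i < n → f i ≡ g i) → ∑ n f ≡ ∑ n g
  ∑-cong zero    {f} {g} f≡g = trans (∑-zero f) (sym (∑-zero g))
  ∑-cong (suc n) {f} {g} f≡g = begin
    ∑ (suc n) f  ≡⟨ ∑-suc n f ⟩
    ∑ n f ∙ f n  ≡⟨ cong₂ _∙_ (∑-cong n (λ i i<n → f≡g i (ℕₚ.m<n⇒m<1+n i<n))) (f≡g n ℕₚ.≤-refl) ⟩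
    ∑ n g ∙ g n  ≡⟨ ∑-suc n g ⟨
    ∑ (suc n) g  ∎

  ∑-first : ∀ n f → ∑ (suc n) f ≡ f 0 ∙ ∑ n (λ i → f (suc i))
  ∑-first zero    f = begin
    ∑ 1 f        ≡⟨ ∑-suc 0 f ⟩
    ∑ 0 f ∙ f 0  ≡⟨ cong (_∙ f 0) (∑-zero f) ⟩
    ε ∙ f 0      ≡⟨ comm ε (f 0) ⟩
    f 0 ∙ ε      ≡⟨ cong (f 0 ∙_) (∑-zero _) ⟨
    f 0 ∙ ∑ 0 (λ i → f (suc i)) ∎
  ∑-first (suc n) f = begin
    ∑ (2 + n) f                                ≡⟨ ∑-suc (suc n) f ⟩
    ∑ (suc n) f ∙ f (suc n)                    ≡⟨ cong (_∙ f (suc n)) (∑-first n f) ⟩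
    (f 0 ∙ ∑ n (λ i → f (suc i))) ∙ f (suc n)   ≡⟨ assoc _ _ _ ⟩
    f 0 ∙ (∑ n (λ i → f (suc i)) ∙ f (suc n))   ≡⟨ cong (f 0 ∙_) (∑-suc n _) ⟨
    f 0 ∙ ∑ (suc n) (λ i → f (suc i))           ∎

  ∑-vanishing-tail : ∀ k f → (∀ i → k ≤ i → f i ≡ ε) → ∀ n → k ≤ n → ∑ n f ≡ ∑ k f
  ∑-vanishing-tail k f tail≡ε n k≤n with ℕₚ.m≤n⇒∃[o]m+o≡n k≤n
  ... | o , refl = go o
    where
    go : ∀ o → ∑ (k + o) f ≡ ∑ k f
    go zero    = cong (λ m → ∑ m f) (ℕₚ.+-identityʳ k)
    go (suc o) = begin
      ∑ (k + suc o) f          ≡⟨ cong (λ m → ∑ m f) (ℕₚ.+-suc k o) ⟩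
      ∑ (suc (k + o)) f        ≡⟨ ∑-suc (k + o) f ⟩
      ∑ (k + o) f ∙ f (k + o)  ≡⟨ cong₂ _∙_ (go o) (tail≡ε (k + o) (ℕₚ.m≤m+n k o)) ⟩
      ∑ k f ∙ ε                ≡⟨ identityʳ _ ⟩
      ∑ k f                    ∎

  ∑-vanishing : ∀ n f → (∀ i → f i ≡ ε) → ∑ n f ≡ ε
  ∑-vanishing n f f≡ε = trans (∑-vanishing-tail 0 f (λ i _ → f≡ε i) n z≤n) (∑-zero f)

  ∑-distrib-∙ : ∀ n f g → ∑ n (λ i → f i ∙ g i) ≡ ∑ n f ∙ ∑ n g
  ∑-distrib-∙ zero    f g = begin
    ∑ 0 _          ≡⟨ ∑-zero _ ⟩
    ε              ≡⟨ identityˡ ε ⟨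
    ε ∙ ε          ≡⟨ cong₂ _∙_ (∑-zero f) (∑-zero g) ⟨
    ∑ 0 f ∙ ∑ 0 g  ∎
  ∑-distrib-∙ (suc n) f g = begin
    ∑ (suc n) _                          ≡⟨ ∑-suc n _ ⟩
    ∑ n (λ i → f i ∙ g i) ∙ (f n ∙ g n)  ≡⟨ cong (_∙ (f n ∙ g n)) (∑-distrib-∙ n f g) ⟩
    (∑ n f ∙ ∑ n g) ∙ (f n ∙ g n)        ≡⟨ interchange _ _ _ _ ⟩
    (∑ n f ∙ f n) ∙ (∑ n g ∙ g n)        ≡⟨ cong₂ _∙_ (∑-suc n f) (∑-suc n g) ⟨
    ∑ (suc n) f ∙ ∑ (suc n) g            ∎

  ∑-homo : (h : A → A) → h ε ≡ ε → (∀ x y → h (x ∙ y) ≡ h x ∙ h y) →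
           ∀ n f → h (∑ n f) ≡ ∑ n (λ i → h (f i))
  ∑-homo h h-ε h-∙ zero    f = trans (cong h (∑-zero f)) (trans h-ε (sym (∑-zero _)))
  ∑-homo h h-ε h-∙ (suc n) f = begin
    h (∑ (suc n) f)                ≡⟨ cong h (∑-suc n f) ⟩
    h (∑ n f ∙ f n)                ≡⟨ h-∙ _ _ ⟩
    h (∑ n f) ∙ h (f n)            ≡⟨ cong (_∙ h (f n)) (∑-homo h h-ε h-∙ n f) ⟩
    ∑ n (λ i → h (f i)) ∙ h (f n)  ≡⟨ ∑-suc n _ ⟨
    ∑ (suc n) (λ i → h (f i))      ∎

  ∑-even-odd : ∀ b h f → b ≤ 1 →
               ∑ (b + 2 * h) f ≡ ∑ (b + h) (λ k → f (2 * k)) ∙ ∑ h (λ k → f (1 + 2 * k))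
  ∑-even-odd zero zero f _ = begin
    ∑ 0 f          ≡⟨ ∑-zero f ⟩
    ε              ≡⟨ identityˡ ε ⟨
    ε ∙ ε          ≡⟨ cong₂ _∙_ (∑-zero _) (∑-zero _) ⟨
    ∑ 0 _ ∙ ∑ 0 _  ∎
  ∑-even-odd zero (suc h) f _ = begin
    ∑ (2 * suc h) f                              ≡⟨ cong (λ m → ∑ m f) (ℕₚ.*-suc 2 h) ⟩
    ∑ (suc (suc (2 * h))) f                      ≡⟨ ∑-suc _ f ⟩
    ∑ (suc (2 * h)) f ∙ f (1 + 2 * h)            ≡⟨ cong (_∙ f (1 + 2 * h)) (∑-even-odd 1 h f (s≤s z≤n)) ⟩
    (∑ (suc h) evens ∙ ∑ h odds) ∙ f (1 + 2 * h) ≡⟨ assoc _ _ _ ⟩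
    ∑ (suc h) evens ∙ (∑ h odds ∙ f (1 + 2 * h)) ≡⟨ cong (∑ (suc h) evens ∙_) (∑-suc h odds) ⟨
    ∑ (suc h) evens ∙ ∑ (suc h) odds             ∎
    where
    evens odds : ℕ → A
    evens k = f (2 * k)
    odds  k = f (1 + 2 * k)
  ∑-even-odd (suc zero) h f _ = begin
    ∑ (suc (2 * h)) f                    ≡⟨ ∑-suc _ f ⟩
    ∑ (2 * h) f ∙ f (2 * h)              ≡⟨ cong (_∙ f (2 * h)) (∑-even-odd 0 h f z≤n) ⟩
    (∑ h evens ∙ ∑ h odds) ∙ f (2 * h)   ≡⟨ xy∙z≈xz∙y _ _ _ ⟨
    (∑ h evens ∙ f (2 * h)) ∙ ∑ h odds   ≡⟨ cong (_∙ ∑ h odds) (∑-suc h evens) ⟨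
    ∑ (suc h) evens ∙ ∑ h odds           ∎
    where
    evens odds : ℕ → A
    evens k = f (2 * k)
    odds  k = f (1 + 2 * k)
  ∑-even-odd (suc (suc _)) h f (s≤s ())

module Σℕ = FiniteSum ℕₚ.+-0-isCommutativeMonoid sumℕ (λ _ → refl) (λ _ _ → refl)
module Σℤ = FiniteSum ℤₚ.+-0-isCommutativeMonoid sumℤ (λ _ → refl) (λ _ _ → refl)
module Σℚ = FiniteSum ℚₚ.+-0-isCommutativeMonoid sumℚ (λ _ → refl) (λ _ _ → refl)

sumℤ-*ˡ : ∀ c n f → sumℤ n (λ i → c ℤ.* f i) ≡ c ℤ.* sumℤ n f
sumℤ-*ˡ c n f = sym (Σℤ.∑-homo (c ℤ.*_) (ℤₚ.*-zeroʳ c) (ℤₚ.*-distribˡ-+ c) n f)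

sumℚ-*ˡ : ∀ c n f → sumℚ n (λ i → c ℚ.* f i) ≡ c ℚ.* sumℚ n f
sumℚ-*ˡ c n f = sym (Σℚ.∑-homo (c ℚ.*_) (ℚₚ.*-zeroʳ c) (ℚₚ.*-distribˡ-+ c) n f)

sumℚ-*ʳ : ∀ c n f → sumℚ n (λ i → f i ℚ.* c) ≡ sumℚ n f ℚ.* c
sumℚ-*ʳ c n f = sym (Σℚ.∑-homo (ℚ._* c) (ℚₚ.*-zeroˡ c) (λ x y → ℚₚ.*-distribʳ-+ c x y) n f)

fromℕ-sumℕ : ∀ n f → fromℕ (sumℕ n f) ≡ sumℚ n (λ i → fromℕ (f i))
fromℕ-sumℕ zero    f = refl
fromℕ-sumℕ (suc n) f = trans (fromℕ-+ (sumℕ n f) (f n)) (cong (ℚ._+ fromℕ (f n)) (fromℕ-sumℕ n f))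

sumℕ-const : ∀ n c → sumℕ n (λ _ → c) ≡ n * c
sumℕ-const zero    c = refl
sumℕ-const (suc n) c = trans (cong (_+ c) (sumℕ-const n c)) (ℕₚ.+-comm (n * c) c)

sumℤ-const-1 : ∀ n → sumℤ n (λ _ → + 1) ≡ + n
sumℤ-const-1 zero    = refl
sumℤ-const-1 (suc n) = trans (cong (ℤ._+ + 1) (sumℤ-const-1 n)) (cong +_ (ℕₚ.+-comm n 1))

sumℕ-mono-≤ : ∀ n {f g} → (∀ i → f i ≤ g i) → sumℕ n f ≤ sumℕ n g
sumℕ-mono-≤ zero    f≤g = z≤n
sumℕ-mono-≤ (suc n) f≤g = ℕₚ.+-mono-≤ (sumℕ-mono-≤ n f≤g) (f≤g n)

-- The proof term used by Defs.bit, so that instances found by unification coincide.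
2^≢0 : ∀ i → NonZero (2 ^ i)
2^≢0 i = ℕ.>-nonZero (ℕₚ.m^n>0 2 i)

n<2^n : ∀ n → n < 2 ^ n
n<2^n zero    = s≤s z≤n
n<2^n (suc n) = ℕₚ.+-mono-≤ (ℕₚ.m^n>0 2 n) (ℕₚ.≤-trans (n<2^n n) (ℕₚ.m≤m+n (2 ^ n) 0))

[b+2k]%2≡b : ∀ b k → b ≤ 1 → (b + 2 * k) % 2 ≡ b
[b+2k]%2≡b b k b≤1 = begin
  (b + 2 * k) % 2  ≡⟨ cong (λ x → (b + x) % 2) (ℕₚ.*-comm 2 k) ⟩
  (b + k * 2) % 2  ≡⟨ ℕ.[m+kn]%n≡m%n b k 2 ⟩
  b % 2            ≡⟨ ℕ.m<n⇒m%n≡m (s≤s b≤1) ⟩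
  b                ∎
  where open ≡-Reasoning

[b+2k]/2≡k : ∀ b k → b ≤ 1 → (b + 2 * k) / 2 ≡ k
[b+2k]/2≡k b k b≤1 = begin
  (b + 2 * k) / 2    ≡⟨ ℕ.+-distrib-/-∣ʳ b (m∣m*n k) ⟩
  b / 2 + 2 * k / 2  ≡⟨ cong₂ _+_ (ℕ.m<n⇒m/n≡0 (s≤s b≤1)) (trans (cong (_/ 2) (ℕₚ.*-comm 2 k)) (ℕ.m*n/n≡m k 2)) ⟩
  k                  ∎
  where open ≡-Reasoning

[2k+m]%2≡m%2 : ∀ k m → (2 * k + m) % 2 ≡ m % 2
[2k+m]%2≡m%2 k m = trans (cong (_% 2) (trans (ℕₚ.+-comm (2 * k) m) (cong (_+_ m) (ℕₚ.*-comm 2 k)))) (ℕ.[m+kn]%n≡m%n m k 2)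

%2≤1 : ∀ n → n % 2 ≤ 1
%2≤1 n = ℕₚ.≤-pred (ℕ.m%n<n n 2)

n%2+2*[n/2]≡n : ∀ n → n % 2 + 2 * (n / 2) ≡ n
n%2+2*[n/2]≡n n = trans (cong (_+_ (n % 2)) (ℕₚ.*-comm 2 (n / 2))) (sym (ℕ.m≡m%n+[m/n]*n n 2))

data BinarySplit : ℕ → Set where
  split : ∀ b h → b ≤ 1 → BinarySplit (b + 2 * h)

binarySplit : ∀ n → BinarySplit n
binarySplit n = subst BinarySplit (n%2+2*[n/2]≡n n) (split (n % 2) (n / 2) (%2≤1 n))

b+2h≤2n⇒b+h≤n : ∀ b h n → b ≤ 1 → b + 2 * h ≤ 2 * n → b + h ≤ n
b+2h≤2n⇒b+h≤n zero          h n _ le = ℕₚ.*-cancelˡ-≤ 2 le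
b+2h≤2n⇒b+h≤n (suc zero)    h n _ le = ℕₚ.*-cancelˡ-< 2 h n le
b+2h≤2n⇒b+h≤n (suc (suc _)) h n (s≤s ()) _

b+2h≤2n⇒h≤n : ∀ b h n → b ≤ 1 → b + 2 * h ≤ 2 * n → h ≤ n
b+2h≤2n⇒h≤n b h n b≤1 le = ℕₚ.≤-trans (ℕₚ.m≤n+m h b) (b+2h≤2n⇒b+h≤n b h n b≤1 le)

2q≤b+2h⇒q≤h : ∀ b q h → b ≤ 1 → 2 * q ≤ b + 2 * h → q ≤ h
2q≤b+2h⇒q≤h zero          q h _ le = ℕₚ.*-cancelˡ-≤ 2 le
2q≤b+2h⇒q≤h (suc zero)    q h _ le =
  ℕₚ.≤-pred (ℕₚ.*-cancelˡ-< 2 q (suc h) (subst (2 * q <_) (sym (ℕₚ.*-suc 2 h)) (s≤s le)))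
2q≤b+2h⇒q≤h (suc (suc _)) q h (s≤s ()) _

1+d+2r≤2[1+r] : ∀ d r → d ≤ 1 → suc (d + 2 * r) ≤ 2 * suc r
1+d+2r≤2[1+r] d r d≤1 = subst (suc (d + 2 * r) ≤_) (sym (ℕₚ.*-suc 2 r)) (s≤s (ℕₚ.+-monoˡ-≤ (2 * r) d≤1))

bit-zero : ∀ b h → b ≤ 1 → bit 0 (b + 2 * h) ≡ b
bit-zero b h b≤1 = trans (cong (_% 2) (ℕ.n/1≡n (b + 2 * h))) ([b+2k]%2≡b b h b≤1)

bit-suc : ∀ i b h → b ≤ 1 → bit (suc i) (b + 2 * h) ≡ bit i h
bit-suc i b h b≤1 = cong (_% 2) (begin
  (b + 2 * h) / (2 * 2 ^ i)  ≡⟨ ℕ.m/n/o≡m/[n*o] (b + 2 * h) 2 (2 ^ i) ⟨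
  (b + 2 * h) / 2 / 2 ^ i    ≡⟨ cong (_/ 2 ^ i) ([b+2k]/2≡k b h b≤1) ⟩
  h / 2 ^ i                  ∎)
  where
  open ≡-Reasoning
  instance
    2^i≢0 : NonZero (2 ^ i)
    2^i≢0 = 2^≢0 i
    2^[1+i]≢0 : NonZero (2 ^ suc i)
    2^[1+i]≢0 = 2^≢0 (suc i)

bit-high : ∀ i k → k ≤ i → bit i k ≡ 0
bit-high i k k≤i = cong (_% 2) (ℕ.m<n⇒m/n≡0 (ℕₚ.≤-<-trans k≤i (n<2^n i)))
  where
  instance
    2^i≢0 : NonZero (2 ^ i)
    2^i≢0 = 2^≢0 i

-- The van der Corput sequence

vdC-term : ℕ → ℕ → ℚ
vdC-term k i = fromℕ (bit i k) ℚ.* recip (2 ^ suc i) {{2^≢0 (suc i)}}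

vdC-as-sum : ∀ k n → k ≤ n → vdC k ≡ sumℚ n (vdC-term k)
vdC-as-sum k n k≤n = begin
  vdC k                       ≡⟨ Σℚ.∑-cong (suc k) (λ i _ → /≡*recip (+ bit i k) (2 ^ suc i) {{2^≢0 (suc i)}}) ⟩
  sumℚ (suc k) (vdC-term k)  ≡⟨ Σℚ.∑-vanishing-tail k (vdC-term k) vanishing (suc k) (ℕₚ.n≤1+n k) ⟩
  sumℚ k (vdC-term k)        ≡⟨ Σℚ.∑-vanishing-tail k (vdC-term k) vanishing n k≤n ⟨
  sumℚ n (vdC-term k)        ∎
  where
  open ≡-Reasoning
  vanishing : ∀ i → k ≤ i → vdC-term k i ≡ 0ℚ
  vanishing i k≤i = trans (cong (λ d → fromℕ d ℚ.* r) (bit-high i k k≤i)) (ℚₚ.*-zeroˡ r)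
    where
    r : ℚ
    r = recip (2 ^ suc i) {{2^≢0 (suc i)}}

vdC-split : ∀ b h → b ≤ 1 → vdC (b + 2 * h) ≡ ½ ℚ.* (fromℕ b ℚ.+ vdC h)
vdC-split b h b≤1 = begin
  vdC n                                               ≡⟨ vdC-as-sum n (suc n) (ℕₚ.n≤1+n n) ⟩
  sumℚ (suc n) (vdC-term n)                          ≡⟨ Σℚ.∑-first n (vdC-term n) ⟩
  vdC-term n 0 ℚ.+ sumℚ n (λ i → vdC-term n (suc i)) ≡⟨ cong₂ ℚ._+_ first (Σℚ.∑-cong n (λ i _ → later i)) ⟩
  fromℕ b ℚ.* ½ ℚ.+ sumℚ n (λ i → ½ ℚ.* vdC-term h i) ≡⟨ cong (fromℕ b ℚ.* ½ ℚ.+_) (sumℚ-*ˡ ½ n (vdC-term h)) ⟩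
  fromℕ b ℚ.* ½ ℚ.+ ½ ℚ.* sumℚ n (vdC-term h)        ≡⟨ cong (λ v → fromℕ b ℚ.* ½ ℚ.+ ½ ℚ.* v) (vdC-as-sum h n h≤n) ⟨
  fromℕ b ℚ.* ½ ℚ.+ ½ ℚ.* vdC h                       ≡⟨ rearrange (fromℕ b) (vdC h) ⟩
  ½ ℚ.* (fromℕ b ℚ.+ vdC h)                           ∎
  where
  open ≡-Reasoning
  n : ℕ
  n = b + 2 * h
  h≤n : h ≤ n
  h≤n = ℕₚ.≤-trans (ℕₚ.m≤m+n h (h + 0)) (ℕₚ.m≤n+m (2 * h) b)
  first : vdC-term n 0 ≡ fromℕ b ℚ.* ½
  first = cong (λ d → fromℕ d ℚ.* ½) (bit-zero b h b≤1)
  later : ∀ i → vdC-term n (suc i) ≡ ½ ℚ.* vdC-term h i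
  later i = trans (cong₂ (λ d r → fromℕ d ℚ.* r) (bit-suc i b h b≤1) (recip-* 2 (2 ^ suc i)))
                  (x*[½*y]≡½*[x*y] (fromℕ (bit i h)) (recip (2 ^ suc i)))
    where
    instance
      2^[1+i]≢0 : NonZero (2 ^ suc i)
      2^[1+i]≢0 = 2^≢0 (suc i)
    x*[½*y]≡½*[x*y] : ∀ x y → x ℚ.* (½ ℚ.* y) ≡ ½ ℚ.* (x ℚ.* y)
    x*[½*y]≡½*[x*y] = solve-∀ ℚ-ring
  rearrange : ∀ x y → x ℚ.* ½ ℚ.+ ½ ℚ.* y ≡ ½ ℚ.* (x ℚ.+ y)
  rearrange = solve-∀ ℚ-ring

½[b+y]-bounds : ∀ b y → b ≤ 1 → 0ℚ ℚ.≤ y → y ℚ.< 1ℚ →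
                0ℚ ℚ.≤ ½ ℚ.* (fromℕ b ℚ.+ y) × ½ ℚ.* (fromℕ b ℚ.+ y) ℚ.< 1ℚ
½[b+y]-bounds b y b≤1 0≤y y<1 =
  ℚₚ.*-monoˡ-≤-nonNeg ½ (ℚₚ.+-mono-≤ (0≤fromℕ b) 0≤y) ,
  ℚₚ.*-monoʳ-<-pos ½ (ℚₚ.+-mono-≤-< (fromℕ-mono-≤ {b} {1} b≤1) y<1)

vdC-bounds : ∀ k → 0ℚ ℚ.≤ vdC k × vdC k ℚ.< 1ℚ
vdC-bounds = <-rec _ bounds
  where
  bounds : ∀ k → (∀ {j} → j < k → 0ℚ ℚ.≤ vdC j × vdC j ℚ.< 1ℚ) → 0ℚ ℚ.≤ vdC k × vdC k ℚ.< 1ℚ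
  bounds zero      _   = ℚₚ.≤-refl , ℚₚ.positive⁻¹ 1ℚ
  bounds k@(suc _) rec = subst (λ y → 0ℚ ℚ.≤ y × y ℚ.< 1ℚ) vdC-k
    (½[b+y]-bounds (k % 2) (vdC (k / 2)) (%2≤1 k) (proj₁ half) (proj₂ half))
    where
    half : 0ℚ ℚ.≤ vdC (k / 2) × vdC (k / 2) ℚ.< 1ℚ
    half = rec (ℕ.m/n<m k 2 (s≤s (s≤s z≤n)))
    vdC-k : ½ ℚ.* (fromℕ (k % 2) ℚ.+ vdC (k / 2)) ≡ vdC k
    vdC-k = trans (sym (vdC-split (k % 2) (k / 2) (%2≤1 k))) (cong vdC (n%2+2*[n/2]≡n k))

vdC-even<½ : ∀ k → vdC (2 * k) ℚ.< ½
vdC-even<½ k = subst (ℚ._< ½) (sym (vdC-split 0 k z≤n))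
  (ℚₚ.*-monoʳ-<-pos ½ (subst (ℚ._< 1ℚ) (sym (ℚₚ.+-identityˡ (vdC k))) (proj₂ (vdC-bounds k))))

½≤vdC-odd : ∀ k → ½ ℚ.≤ vdC (1 + 2 * k)
½≤vdC-odd k = subst (½ ℚ.≤_) (sym (vdC-split 1 k (s≤s z≤n)))
  (ℚₚ.*-monoˡ-≤-nonNeg ½ (subst (ℚ._≤ 1ℚ ℚ.+ vdC k) (ℚₚ.+-identityʳ 1ℚ) (ℚₚ.+-monoʳ-≤ 1ℚ (proj₁ (vdC-bounds k)))))

vdC-even≤vdC : ∀ r → vdC (2 * r) ℚ.≤ vdC r
vdC-even≤vdC r = begin
  vdC (2 * r)              ≡⟨ vdC-split 0 r z≤n ⟩
  ½ ℚ.* (0ℚ ℚ.+ vdC r)     ≡⟨ cong (ℚ._*_ ½) (ℚₚ.+-identityˡ (vdC r)) ⟩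
  ½ ℚ.* vdC r              ≤⟨ *-monoʳ-≤ (proj₁ (vdC-bounds r)) ½≤1 ⟩
  1ℚ ℚ.* vdC r             ≡⟨ ℚₚ.*-identityˡ (vdC r) ⟩
  vdC r                    ∎
  where
  open ℚₚ.≤-Reasoning
  ½≤1 : ½ ℚ.≤ 1ℚ
  ½≤1 = ℚ.*≤* (ℤ.+≤+ (s≤s z≤n))

vdC<vdC-odd : ∀ r → vdC r ℚ.< vdC (1 + 2 * r)
vdC<vdC-odd r = begin-strict
  vdC r                    ≡⟨ halves (vdC r) ⟩
  ½ ℚ.* (vdC r ℚ.+ vdC r)  <⟨ ℚₚ.*-monoʳ-<-pos ½ (ℚₚ.+-monoˡ-< (vdC r) (proj₂ (vdC-bounds r))) ⟩
  ½ ℚ.* (1ℚ ℚ.+ vdC r)     ≡⟨ vdC-split 1 r (s≤s z≤n) ⟨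
  vdC (1 + 2 * r)          ∎
  where
  open ℚₚ.≤-Reasoning
  halves : ∀ y → y ≡ ½ ℚ.* (y ℚ.+ y)
  halves = solve-∀ ℚ-ring

vdC-prefix : ℕ → ℕ → ℕ
vdC-prefix j k = ℤ.∣ floor (fromℕ (2 ^ j) ℚ.* vdC k) ∣

floor-2^j*vdC : ∀ j k → floor (fromℕ (2 ^ j) ℚ.* vdC k) ≡ + vdC-prefix j k
floor-2^j*vdC j k = floor-nonNeg _ (0≤p*q (0≤fromℕ (2 ^ j)) (proj₁ (vdC-bounds k)))

vdC-prefix-zero : ∀ k → vdC-prefix 0 k ≡ 0
vdC-prefix-zero k = cong ℤ.∣_∣ (trans (cong floor (ℚₚ.*-identityˡ (vdC k)))
  (floor-unique (+ 0) (vdC k) (proj₁ (vdC-bounds k)) (proj₂ (vdC-bounds k))))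

vdC-prefix-suc : ∀ j b h → b ≤ 1 → vdC-prefix (suc j) (b + 2 * h) ≡ 2 ^ j * b + vdC-prefix j h
vdC-prefix-suc j b h b≤1 = cong ℤ.∣_∣ (begin
  floor (fromℕ (2 * 2 ^ j) ℚ.* vdC (b + 2 * h))                   ≡⟨ cong (λ y → floor (fromℕ (2 * 2 ^ j) ℚ.* y)) (vdC-split b h b≤1) ⟩
  floor (fromℕ (2 * 2 ^ j) ℚ.* (½ ℚ.* (fromℕ b ℚ.+ vdC h)))       ≡⟨ cong floor (rescaled (vdC h)) ⟩
  floor (fromℤ (+ (2 ^ j * b)) ℚ.+ fromℕ (2 ^ j) ℚ.* vdC h)       ≡⟨ floor-fromℤ-+ (+ (2 ^ j * b)) _ ⟩
  + (2 ^ j * b) ℤ.+ floor (fromℕ (2 ^ j) ℚ.* vdC h)               ≡⟨ cong (ℤ._+_ (+ (2 ^ j * b))) (floor-2^j*vdC j h) ⟩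
  + (2 ^ j * b + vdC-prefix j h)                                 ∎)
  where
  open ≡-Reasoning
  distrib : ∀ p b y → fromℕ 2 ℚ.* p ℚ.* (½ ℚ.* (b ℚ.+ y)) ≡ p ℚ.* b ℚ.+ p ℚ.* y
  distrib = solve-∀ ℚ-ring
  rescaled : ∀ y → fromℕ (2 * 2 ^ j) ℚ.* (½ ℚ.* (fromℕ b ℚ.+ y)) ≡ fromℕ (2 ^ j * b) ℚ.+ fromℕ (2 ^ j) ℚ.* y
  rescaled y = begin
    fromℕ (2 * 2 ^ j) ℚ.* (½ ℚ.* (fromℕ b ℚ.+ y))            ≡⟨ cong (ℚ._* (½ ℚ.* (fromℕ b ℚ.+ y))) (fromℕ-* 2 (2 ^ j)) ⟩
    fromℕ 2 ℚ.* fromℕ (2 ^ j) ℚ.* (½ ℚ.* (fromℕ b ℚ.+ y))    ≡⟨ distrib (fromℕ (2 ^ j)) (fromℕ b) y ⟩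
    fromℕ (2 ^ j) ℚ.* fromℕ b ℚ.+ fromℕ (2 ^ j) ℚ.* y        ≡⟨ cong (ℚ._+ fromℕ (2 ^ j) ℚ.* y) (fromℕ-* (2 ^ j) b) ⟨
    fromℕ (2 ^ j * b) ℚ.+ fromℕ (2 ^ j) ℚ.* y                ∎

vdC-prefix-parity : ∀ i k → vdC-prefix (suc i) k % 2 ≡ bit i k
vdC-prefix-parity i k with binarySplit k
vdC-prefix-parity zero    _ | split b h b≤1 = begin
  vdC-prefix 1 (b + 2 * h) % 2  ≡⟨ cong (_% 2) (vdC-prefix-suc 0 b h b≤1) ⟩
  (1 * b + vdC-prefix 0 h) % 2  ≡⟨ cong₂ (λ x y → (x + y) % 2) (ℕₚ.*-identityˡ b) (vdC-prefix-zero h) ⟩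
  (b + 0) % 2                   ≡⟨ [b+2k]%2≡b b 0 b≤1 ⟩
  b                             ≡⟨ bit-zero b h b≤1 ⟨
  bit 0 (b + 2 * h)             ∎
  where open ≡-Reasoning
vdC-prefix-parity (suc i) _ | split b h b≤1 = begin
  vdC-prefix (2 + i) (b + 2 * h) % 2              ≡⟨ cong (_% 2) (vdC-prefix-suc (suc i) b h b≤1) ⟩
  (2 * 2 ^ i * b + vdC-prefix (suc i) h) % 2      ≡⟨ cong (λ x → (x + vdC-prefix (suc i) h) % 2) (ℕₚ.*-assoc 2 (2 ^ i) b) ⟩
  (2 * (2 ^ i * b) + vdC-prefix (suc i) h) % 2    ≡⟨ [2k+m]%2≡m%2 (2 ^ i * b) _ ⟩
  vdC-prefix (suc i) h % 2                        ≡⟨ vdC-prefix-parity i h ⟩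
  bit i h                                         ≡⟨ bit-suc i b h b≤1 ⟨
  bit (suc i) (b + 2 * h)                         ∎
  where open ≡-Reasoning

digit-vdC : ∀ i k → digit (suc i) (vdC k) ≡ bit i k
digit-vdC i k = trans (cong (ℤ._%ℕ 2) (floor-2^j*vdC (suc i) k)) (vdC-prefix-parity i k)

-- Walsh sums along the sequence

signPow-suc : ∀ e → signPow (suc e) ≡ ℤ.- signPow e
signPow-suc zero          = refl
signPow-suc (suc zero)    = refl
signPow-suc (suc (suc e)) = signPow-suc e

signPow-+ : ∀ x y → signPow (x + y) ≡ signPow x ℤ.* signPow y
signPow-+ zero    y = sym (ℤₚ.*-identityˡ (signPow y))
signPow-+ (suc x) y = begin
  signPow (suc (x + y))             ≡⟨ signPow-suc (x + y) ⟩
  ℤ.- signPow (x + y)               ≡⟨ cong ℤ.-_ (signPow-+ x y) ⟩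
  ℤ.- (signPow x ℤ.* signPow y)     ≡⟨ ℤₚ.neg-distribˡ-* (signPow x) (signPow y) ⟩
  ℤ.- signPow x ℤ.* signPow y       ≡⟨ cong (ℤ._* signPow y) (signPow-suc x) ⟨
  signPow (suc x) ℤ.* signPow y     ∎
  where open ≡-Reasoning

∣signPow∣≡1 : ∀ e → ℤ.∣ signPow e ∣ ≡ 1
∣signPow∣≡1 zero          = refl
∣signPow∣≡1 (suc zero)    = refl
∣signPow∣≡1 (suc (suc e)) = ∣signPow∣≡1 e

bitProduct : ℕ → ℕ → ℕ → ℕ
bitProduct s m k = sumℕ s (λ i → bit i m * bit i k)

bitProduct-stable : ∀ s m k → m ≤ s → bitProduct s m k ≡ bitProduct m m k
bitProduct-stable s m k m≤s = Σℕ.∑-vanishing-tail m _ (λ i m≤i → cong (_* bit i k) (bit-high i m m≤i)) s m≤s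

walshSign : ℕ → ℕ → ℤ
walshSign m k = signPow (bitProduct (suc m) m k)

wal-vdC : ∀ m k → wal m (vdC k) ≡ walshSign m k
wal-vdC m k = cong signPow (Σℕ.∑-cong (suc m) (λ i _ → cong (bit i m *_) (digit-vdC i k)))

walshSign-split : ∀ c m b k → c ≤ 1 → b ≤ 1 →
                  walshSign (c + 2 * m) (b + 2 * k) ≡ signPow (c * b) ℤ.* walshSign m k
walshSign-split c m b k c≤1 b≤1 = begin
  signPow (bitProduct (suc M) M K)                                      ≡⟨ cong signPow (Σℕ.∑-first M _) ⟩
  signPow (bit 0 M * bit 0 K + sumℕ M (λ i → bit (suc i) M * bit (suc i) K))
    ≡⟨ cong signPow (cong₂ _+_ (cong₂ _*_ (bit-zero c m c≤1) (bit-zero b k b≤1))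
                               (Σℕ.∑-cong M (λ i _ → cong₂ _*_ (bit-suc i c m c≤1) (bit-suc i b k b≤1)))) ⟩
  signPow (c * b + bitProduct M m k)                                    ≡⟨ cong (λ p → signPow (c * b + p)) stable ⟩
  signPow (c * b + bitProduct (suc m) m k)                              ≡⟨ signPow-+ (c * b) _ ⟩
  signPow (c * b) ℤ.* walshSign m k                                     ∎
  where
  open ≡-Reasoning
  M K : ℕ
  M = c + 2 * m
  K = b + 2 * k
  m≤M : m ≤ M
  m≤M = ℕₚ.≤-trans (ℕₚ.m≤m+n m (m + 0)) (ℕₚ.m≤n+m (2 * m) c)
  stable : bitProduct M m k ≡ bitProduct (suc m) m k
  stable = trans (bitProduct-stable M m k m≤M) (sym (bitProduct-stable (suc m) m k (ℕₚ.n≤1+n m)))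

walshSum : ℕ → ℕ → ℤ
walshSum m n = sumℤ n (walshSign m)

walshSum-split : ∀ c m b h → c ≤ 1 → b ≤ 1 →
                 walshSum (c + 2 * m) (b + 2 * h) ≡ walshSum m (b + h) ℤ.+ signPow c ℤ.* walshSum m h
walshSum-split c m b h c≤1 b≤1 = begin
  walshSum M (b + 2 * h)
    ≡⟨ Σℤ.∑-even-odd b h (walshSign M) b≤1 ⟩
  sumℤ (b + h) (λ k → walshSign M (2 * k)) ℤ.+ sumℤ h (λ k → walshSign M (1 + 2 * k))
    ≡⟨ cong₂ ℤ._+_ (Σℤ.∑-cong (b + h) (λ k _ → even k)) (Σℤ.∑-cong h (λ k _ → odd k)) ⟩
  walshSum m (b + h) ℤ.+ sumℤ h (λ k → signPow c ℤ.* walshSign m k)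
    ≡⟨ cong (ℤ._+_ (walshSum m (b + h))) (sumℤ-*ˡ (signPow c) h (walshSign m)) ⟩
  walshSum m (b + h) ℤ.+ signPow c ℤ.* walshSum m h
    ∎
  where
  open ≡-Reasoning
  M : ℕ
  M = c + 2 * m
  even : ∀ k → walshSign M (2 * k) ≡ walshSign m k
  even k = trans (walshSign-split c m 0 k c≤1 z≤n)
                 (trans (cong (λ e → signPow e ℤ.* walshSign m k) (ℕₚ.*-zeroʳ c)) (ℤₚ.*-identityˡ _))
  odd : ∀ k → walshSign M (1 + 2 * k) ≡ signPow c ℤ.* walshSign m k
  odd k = trans (walshSign-split c m 1 k c≤1 (s≤s z≤n)) (cong (λ e → signPow e ℤ.* walshSign m k) (ℕₚ.*-identityʳ c))

-- For n ≤ 2^L, Δ L n = 2^L · n · D_n^*; the recursion is the one shared by the Walsh sums and by E.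
Δ : ℕ → ℕ → ℕ
Δ zero    n = n
Δ (suc L) n = Δ L (n / 2) + Δ L (n % 2 + n / 2) + 2 ^ L * (n % 2)

Δ-split : ∀ L b h → b ≤ 1 → Δ (suc L) (b + 2 * h) ≡ Δ L h + Δ L (b + h) + 2 ^ L * b
Δ-split L b h b≤1 rewrite [b+2k]/2≡k b h b≤1 | [b+2k]%2≡b b h b≤1 = refl

∣i+i∣≡∣i∣+∣i∣ : ∀ i → ℤ.∣ i ℤ.+ i ∣ ≡ ℤ.∣ i ∣ + ℤ.∣ i ∣
∣i+i∣≡∣i∣+∣i∣ (+ n)    = refl
∣i+i∣≡∣i∣+∣i∣ -[1+ n ] = cong suc (sym (ℕₚ.+-suc n n))

∣i+sucᵢ∣≡∣i∣+∣sucᵢ∣ : ∀ i → ℤ.∣ i ℤ.+ ℤ.suc i ∣ ≡ ℤ.∣ i ∣ + ℤ.∣ ℤ.suc i ∣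
∣i+sucᵢ∣≡∣i∣+∣sucᵢ∣ (+ n)          = refl
∣i+sucᵢ∣≡∣i∣+∣sucᵢ∣ -[1+ zero ]    = refl
∣i+sucᵢ∣≡∣i∣+∣sucᵢ∣ -[1+ suc n ]   = cong (suc ∘ suc) (sym (ℕₚ.+-suc n n))

∣[y+e]+y∣+∣[y+e]-y∣ : ∀ y e → ℤ.∣ e ∣ ≡ 1 →
              ℤ.∣ (y ℤ.+ e) ℤ.+ y ∣ + ℤ.∣ (y ℤ.+ e) ℤ.- y ∣ ≡ ℤ.∣ y ∣ + ℤ.∣ y ℤ.+ e ∣ + 1
∣[y+e]+y∣+∣[y+e]-y∣ y (+ 1) _ = begin
  ℤ.∣ y ℤ.+ + 1 ℤ.+ y ∣ + ℤ.∣ y ℤ.+ + 1 ℤ.- y ∣  ≡⟨ cong₂ (λ s d → ℤ.∣ s ∣ + ℤ.∣ d ∣) (lem₁ y) (lem₂ y) ⟩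
  ℤ.∣ y ℤ.+ ℤ.suc y ∣ + 1                         ≡⟨ cong (_+ 1) (∣i+sucᵢ∣≡∣i∣+∣sucᵢ∣ y) ⟩
  ℤ.∣ y ∣ + ℤ.∣ ℤ.suc y ∣ + 1                     ≡⟨ cong (λ x → ℤ.∣ y ∣ + ℤ.∣ x ∣ + 1) (ℤₚ.+-comm (+ 1) y) ⟩
  ℤ.∣ y ∣ + ℤ.∣ y ℤ.+ + 1 ∣ + 1                   ∎
  where
  open ≡-Reasoning
  lem₁ : ∀ y → y ℤ.+ + 1 ℤ.+ y ≡ y ℤ.+ (+ 1 ℤ.+ y)
  lem₁ = ℤ-Solver.solve-∀
  lem₂ : ∀ y → y ℤ.+ + 1 ℤ.- y ≡ + 1
  lem₂ = ℤ-Solver.solve-∀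
∣[y+e]+y∣+∣[y+e]-y∣ y -[1+ 0 ] _ = begin
  ℤ.∣ x ℤ.+ y ∣ + ℤ.∣ x ℤ.- y ∣       ≡⟨ cong₂ (λ s d → ℤ.∣ s ∣ + ℤ.∣ d ∣) (lem₁ y) (lem₂ y) ⟩
  ℤ.∣ x ℤ.+ ℤ.suc x ∣ + 1             ≡⟨ cong (_+ 1) (∣i+sucᵢ∣≡∣i∣+∣sucᵢ∣ x) ⟩
  ℤ.∣ x ∣ + ℤ.∣ ℤ.suc x ∣ + 1         ≡⟨ cong (λ z → ℤ.∣ x ∣ + ℤ.∣ z ∣ + 1) (lem₃ y) ⟩
  ℤ.∣ x ∣ + ℤ.∣ y ∣ + 1               ≡⟨ cong (_+ 1) (ℕₚ.+-comm ℤ.∣ x ∣ ℤ.∣ y ∣) ⟩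
  ℤ.∣ y ∣ + ℤ.∣ x ∣ + 1               ∎
  where
  open ≡-Reasoning
  x : ℤ
  x = y ℤ.+ -[1+ 0 ]
  lem₁ : ∀ y → y ℤ.+ -[1+ 0 ] ℤ.+ y ≡ y ℤ.+ -[1+ 0 ] ℤ.+ (+ 1 ℤ.+ (y ℤ.+ -[1+ 0 ]))
  lem₁ = ℤ-Solver.solve-∀
  lem₂ : ∀ y → y ℤ.+ -[1+ 0 ] ℤ.- y ≡ -[1+ 0 ]
  lem₂ = ℤ-Solver.solve-∀
  lem₃ : ∀ y → + 1 ℤ.+ (y ℤ.+ -[1+ 0 ]) ≡ y
  lem₃ = ℤ-Solver.solve-∀

walshSum-pair : ∀ m b h → b ≤ 1 →
                ℤ.∣ walshSum (2 * m) (b + 2 * h) ∣ + ℤ.∣ walshSum (1 + 2 * m) (b + 2 * h) ∣ ≡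
                ℤ.∣ walshSum m h ∣ + ℤ.∣ walshSum m (b + h) ∣ + b
walshSum-pair m b h b≤1
  rewrite walshSum-split 0 m b h z≤n b≤1 | walshSum-split 1 m b h (s≤s z≤n) b≤1
        | ℤₚ.*-identityˡ (walshSum m h) | ℤₚ.-1*i≡-i (walshSum m h) = pair b b≤1
  where
  y : ℤ
  y = walshSum m h
  pair : ∀ b → b ≤ 1 →
         ℤ.∣ walshSum m (b + h) ℤ.+ y ∣ + ℤ.∣ walshSum m (b + h) ℤ.- y ∣ ≡ ℤ.∣ y ∣ + ℤ.∣ walshSum m (b + h) ∣ + b
  pair zero _ rewrite ℤₚ.+-inverseʳ y = trans (ℕₚ.+-identityʳ _) (trans (∣i+i∣≡∣i∣+∣i∣ y) (sym (ℕₚ.+-identityʳ _)))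
  pair (suc zero) _ = ∣[y+e]+y∣+∣[y+e]-y∣ y (walshSign m h) (∣signPow∣≡1 (bitProduct (suc m) m h))
  pair (suc (suc _)) (s≤s ())

walshSum-abs-total : ∀ L n → sumℕ (2 ^ L) (λ m → ℤ.∣ walshSum m n ∣) ≡ Δ L n
walshSum-abs-total zero    n = cong ℤ.∣_∣ (sumℤ-const-1 n)
walshSum-abs-total (suc L) n with binarySplit n
... | split b h b≤1 = begin
  sumℕ (2 * 2 ^ L) ∣S_n∣
    ≡⟨ Σℕ.∑-even-odd 0 (2 ^ L) ∣S_n∣ z≤n ⟩
  sumℕ (2 ^ L) (λ m → ∣S_n∣ (2 * m)) + sumℕ (2 ^ L) (λ m → ∣S_n∣ (1 + 2 * m))
    ≡⟨ Σℕ.∑-distrib-∙ (2 ^ L) _ _ ⟨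
  sumℕ (2 ^ L) (λ m → ∣S_n∣ (2 * m) + ∣S_n∣ (1 + 2 * m))
    ≡⟨ Σℕ.∑-cong (2 ^ L) (λ m _ → walshSum-pair m b h b≤1) ⟩
  sumℕ (2 ^ L) (λ m → ∣S∣ h m + ∣S∣ (b + h) m + b)
    ≡⟨ Σℕ.∑-distrib-∙ (2 ^ L) _ _ ⟩
  sumℕ (2 ^ L) (λ m → ∣S∣ h m + ∣S∣ (b + h) m) + sumℕ (2 ^ L) (λ _ → b)
    ≡⟨ cong₂ _+_ (Σℕ.∑-distrib-∙ (2 ^ L) _ _) (sumℕ-const (2 ^ L) b) ⟩
  sumℕ (2 ^ L) (∣S∣ h) + sumℕ (2 ^ L) (∣S∣ (b + h)) + 2 ^ L * b
    ≡⟨ cong (_+ 2 ^ L * b) (cong₂ _+_ (walshSum-abs-total L h) (walshSum-abs-total L (b + h))) ⟩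
  Δ L h + Δ L (b + h) + 2 ^ L * b
    ≡⟨ Δ-split L b h b≤1 ⟨
  Δ (suc L) (b + 2 * h)
    ∎
  where
  open ≡-Reasoning
  ∣S∣ : ℕ → ℕ → ℕ
  ∣S∣ n m = ℤ.∣ walshSum m n ∣
  ∣S_n∣ : ℕ → ℕ
  ∣S_n∣ = ∣S∣ (b + 2 * h)

walshRHS≡Δ : ∀ n n1 .{{_ : NonZero n}} →
             walshRHS n n1 ≡ recip (2 ^ suc n1) {{2^≢0 (suc n1)}} ℚ.* (fromℕ (Δ (suc n1) n) ℚ.* recip n)
walshRHS≡Δ n n1 = cong (ℚ._*_ (recip (2 ^ L) {{2^≢0 L}})) (begin
  sumℚ (2 ^ L) (λ m → ℚ.∣ sumℤ n (λ k → wal m (vdC k)) ℚ./ n ∣)  ≡⟨ Σℚ.∑-cong (2 ^ L) (λ m _ → term m) ⟩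
  sumℚ (2 ^ L) (λ m → fromℕ (∣S∣ m) ℚ.* recip n)                ≡⟨ sumℚ-*ʳ (recip n) (2 ^ L) (λ m → fromℕ (∣S∣ m)) ⟩
  sumℚ (2 ^ L) (λ m → fromℕ (∣S∣ m)) ℚ.* recip n                ≡⟨ cong (ℚ._* recip n) (fromℕ-sumℕ (2 ^ L) ∣S∣) ⟨
  fromℕ (sumℕ (2 ^ L) ∣S∣) ℚ.* recip n                          ≡⟨ cong (λ x → fromℕ x ℚ.* recip n) (walshSum-abs-total L n) ⟩
  fromℕ (Δ L n) ℚ.* recip n                                      ∎)
  where
  open ≡-Reasoning
  L : ℕ
  L = suc n1
  ∣S∣ : ℕ → ℕ
  ∣S∣ m = ℤ.∣ walshSum m n ∣
  term : ∀ m → ℚ.∣ sumℤ n (λ k → wal m (vdC k)) ℚ./ n ∣ ≡ fromℕ (∣S∣ m) ℚ.* recip n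
  term m = trans (cong (λ z → ℚ.∣ z ℚ./ n ∣) (Σℤ.∑-cong n (λ k _ → wal-vdC m k))) (∣z/n∣≡∣z∣*recip (walshSum m n) n)

𝟙[_] : {P : Set} → Dec P → ℕ
𝟙[ p? ] = if does p? then 1 else 0

𝟙-yes : {P : Set} (p? : Dec P) → P → 𝟙[ p? ] ≡ 1
𝟙-yes p? p = cong (if_then 1 else 0) (dec-true p? p)

𝟙-no : {P : Set} (p? : Dec P) → ¬ P → 𝟙[ p? ] ≡ 0
𝟙-no p? ¬p = cong (if_then 1 else 0) (dec-false p? ¬p)

𝟙-⇔ : {P Q : Set} → P ⇔ Q → (p? : Dec P) (q? : Dec Q) → 𝟙[ p? ] ≡ 𝟙[ q? ]
𝟙-⇔ P⇔Q p? q? = cong (if_then 1 else 0) (does-⇔ P⇔Q p? q?)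

𝟙≤1 : {P : Set} (p? : Dec P) → 𝟙[ p? ] ≤ 1
𝟙≤1 (yes _) = ℕₚ.≤-refl
𝟙≤1 (no _)  = z≤n

𝟙-mono : {P Q : Set} (p? : Dec P) (q? : Dec Q) → (P → Q) → 𝟙[ p? ] ≤ 𝟙[ q? ]
𝟙-mono (yes _) (yes _) _   = ℕₚ.≤-refl
𝟙-mono (yes p) (no ¬q) P→Q = ⊥-elim (¬q (P→Q p))
𝟙-mono (no _)  _       _   = z≤n

rescale : ℕ → ℚ → ℚ
rescale a t = fromℕ 2 ℚ.* t ℚ.- fromℕ a

rescale-bounds : ∀ a t → ½ ℚ.* fromℕ a ℚ.≤ t → t ℚ.≤ ½ ℚ.* (fromℕ a ℚ.+ 1ℚ) →
                 0ℚ ℚ.≤ rescale a t × rescale a t ℚ.≤ 1ℚ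
rescale-bounds a t lo hi =
  subst (ℚ._≤ rescale a t) (left-end (fromℕ a)) (≤-affine (fromℕ 2) (ℚ.- fromℕ a) (ℚₚ.positive⁻¹ (fromℕ 2)) lo) ,
  subst (rescale a t ℚ.≤_) (right-end (fromℕ a)) (≤-affine (fromℕ 2) (ℚ.- fromℕ a) (ℚₚ.positive⁻¹ (fromℕ 2)) hi)
  where
  left-end : ∀ a → fromℕ 2 ℚ.* (½ ℚ.* a) ℚ.+ ℚ.- a ≡ 0ℚ
  left-end = solve-∀ ℚ-ring
  right-end : ∀ a → fromℕ 2 ℚ.* (½ ℚ.* (a ℚ.+ 1ℚ)) ℚ.+ ℚ.- a ≡ 1ℚ
  right-end = solve-∀ ℚ-ring

rescale-vdC : ∀ d r → d ≤ 1 → rescale d (vdC (d + 2 * r)) ≡ vdC r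
rescale-vdC d r d≤1 = trans (cong (rescale d) (vdC-split d r d≤1)) (expand (fromℕ d) (vdC r))
  where
  expand : ∀ a y → fromℕ 2 ℚ.* (½ ℚ.* (a ℚ.+ y)) ℚ.- a ≡ y
  expand = solve-∀ ℚ-ring

module Counting {_◃_ : ℚ → ℚ → Set} (_◃?_ : Decidable _◃_)
  (◃-affine : ∀ c d {x y} → 0ℚ ℚ.< c → x ◃ y → (c ℚ.* x ℚ.+ d) ◃ (c ℚ.* y ℚ.+ d)) where

  pointsBelow : ℕ → ℚ → ℕ
  pointsBelow n t = sumℕ n (λ k → 𝟙[ vdC k ◃? t ])

  excess : ℕ → ℚ → ℚ
  excess n t = fromℕ (pointsBelow n t) ℚ.- fromℕ n ℚ.* t

  ◃-rescale : ∀ a y t → ((½ ℚ.* (fromℕ a ℚ.+ y)) ◃ t) ⇔ (y ◃ rescale a t)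
  ◃-rescale a y t = mk⇔
    (λ shrunk◃t → subst (λ x → x ◃ rescale a t) (expand (fromℕ a) y)
                    (◃-affine (fromℕ 2) (ℚ.- fromℕ a) (ℚₚ.positive⁻¹ (fromℕ 2)) shrunk◃t))
    (λ y◃t′ → subst₂ _◃_ (shrink (fromℕ a) y) (shrink-expand (fromℕ a) t)
                (◃-affine ½ (½ ℚ.* fromℕ a) (ℚₚ.positive⁻¹ ½) y◃t′))
    where
    expand : ∀ a y → fromℕ 2 ℚ.* (½ ℚ.* (a ℚ.+ y)) ℚ.+ ℚ.- a ≡ y
    expand = solve-∀ ℚ-ring
    shrink : ∀ a y → ½ ℚ.* y ℚ.+ ½ ℚ.* a ≡ ½ ℚ.* (a ℚ.+ y)
    shrink = solve-∀ ℚ-ring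
    shrink-expand : ∀ a t → ½ ℚ.* (fromℕ 2 ℚ.* t ℚ.- a) ℚ.+ ½ ℚ.* a ≡ t
    shrink-expand = solve-∀ ℚ-ring

  𝟙-vdC-rescale : ∀ a k t → a ≤ 1 → 𝟙[ vdC (a + 2 * k) ◃? t ] ≡ 𝟙[ vdC k ◃? rescale a t ]
  𝟙-vdC-rescale a k t a≤1 = 𝟙-⇔
    (subst (λ y → (y ◃ t) ⇔ (vdC k ◃ rescale a t)) (sym (vdC-split a k a≤1)) (◃-rescale a (vdC k) t))
    (vdC (a + 2 * k) ◃? t) (vdC k ◃? rescale a t)

  pointsBelow-lower : ∀ b h t → b ≤ 1 → (∀ k → ¬ (vdC (1 + 2 * k) ◃ t)) →
                      pointsBelow (b + 2 * h) t ≡ pointsBelow (b + h) (rescale 0 t)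
  pointsBelow-lower b h t b≤1 odd-above = begin
    pointsBelow (b + 2 * h) t                                      ≡⟨ Σℕ.∑-even-odd b h _ b≤1 ⟩
    sumℕ (b + h) (λ k → 𝟙[ vdC (2 * k) ◃? t ]) + sumℕ h (λ k → 𝟙[ vdC (1 + 2 * k) ◃? t ])
      ≡⟨ cong₂ _+_ (Σℕ.∑-cong (b + h) (λ k _ → 𝟙-vdC-rescale 0 k t z≤n))
                   (Σℕ.∑-vanishing h _ (λ k → 𝟙-no (vdC (1 + 2 * k) ◃? t) (odd-above k))) ⟩
    pointsBelow (b + h) (rescale 0 t) + 0                          ≡⟨ ℕₚ.+-identityʳ _ ⟩
    pointsBelow (b + h) (rescale 0 t)                              ∎
    where open ≡-Reasoning

  pointsBelow-upper : ∀ b h t → b ≤ 1 → (∀ k → vdC (2 * k) ◃ t) →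
                      pointsBelow (b + 2 * h) t ≡ (b + h) + pointsBelow h (rescale 1 t)
  pointsBelow-upper b h t b≤1 even-below = begin
    pointsBelow (b + 2 * h) t                                      ≡⟨ Σℕ.∑-even-odd b h _ b≤1 ⟩
    sumℕ (b + h) (λ k → 𝟙[ vdC (2 * k) ◃? t ]) + sumℕ h (λ k → 𝟙[ vdC (1 + 2 * k) ◃? t ])
      ≡⟨ cong₂ _+_ (Σℕ.∑-cong (b + h) (λ k _ → 𝟙-yes (vdC (2 * k) ◃? t) (even-below k)))
                   (Σℕ.∑-cong h (λ k _ → 𝟙-vdC-rescale 1 k t (s≤s z≤n))) ⟩
    sumℕ (b + h) (λ _ → 1) + pointsBelow h (rescale 1 t)
      ≡⟨ cong (_+ pointsBelow h (rescale 1 t)) (trans (sumℕ-const (b + h) 1) (ℕₚ.*-identityʳ (b + h))) ⟩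
    b + h + pointsBelow h (rescale 1 t)                            ∎
    where open ≡-Reasoning

  pointsBelow-next : ∀ b h t → b ≤ 1 → pointsBelow (b + h) t ≡ pointsBelow h t + b * 𝟙[ vdC h ◃? t ]
  pointsBelow-next zero          h t _ = sym (ℕₚ.+-identityʳ _)
  pointsBelow-next (suc zero)    h t _ = cong (_+_ (pointsBelow h t)) (sym (ℕₚ.+-identityʳ _))
  pointsBelow-next (suc (suc _)) h t (s≤s ())

  private
    fromℕ-next : ∀ b h t → b ≤ 1 →
                 fromℕ (pointsBelow (b + h) t) ≡ fromℕ (pointsBelow h t) ℚ.+ fromℕ b ℚ.* fromℕ 𝟙[ vdC h ◃? t ]
    fromℕ-next b h t b≤1 = trans (cong fromℕ (pointsBelow-next b h t b≤1))
                                 (trans (fromℕ-+ (pointsBelow h t) _) (cong (ℚ._+_ (fromℕ (pointsBelow h t))) (fromℕ-* b 𝟙[ vdC h ◃? t ])))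

    fromℕ-b+2h : ∀ b h → fromℕ (b + 2 * h) ≡ fromℕ b ℚ.+ fromℕ 2 ℚ.* fromℕ h
    fromℕ-b+2h b h = trans (fromℕ-+ b (2 * h)) (cong (ℚ._+_ (fromℕ b)) (fromℕ-* 2 h))

  excess-lower : ∀ b h t → b ≤ 1 → (∀ k → ¬ (vdC (1 + 2 * k) ◃ t)) →
                 fromℕ 2 ℚ.* excess (b + 2 * h) t ≡
                 excess h (rescale 0 t) ℚ.+ excess (b + h) (rescale 0 t) ℚ.+ fromℕ b ℚ.* fromℕ 𝟙[ vdC h ◃? rescale 0 t ]
  excess-lower b h t b≤1 odd-above = begin
    fromℕ 2 ℚ.* excess (b + 2 * h) t
      ≡⟨ cong₂ (λ c n → fromℕ 2 ℚ.* (c ℚ.- n ℚ.* t))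
               (trans (cong fromℕ (pointsBelow-lower b h t b≤1 odd-above)) (fromℕ-next b h s b≤1)) (fromℕ-b+2h b h) ⟩
    fromℕ 2 ℚ.* ((C ℚ.+ B ℚ.* X) ℚ.- (B ℚ.+ fromℕ 2 ℚ.* H) ℚ.* t)
      ≡⟨ identity C B X H t ⟩
    (C ℚ.- H ℚ.* s) ℚ.+ ((C ℚ.+ B ℚ.* X) ℚ.- (B ℚ.+ H) ℚ.* s) ℚ.+ B ℚ.* X
      ≡⟨ cong₂ (λ c n → (C ℚ.- H ℚ.* s) ℚ.+ (c ℚ.- n ℚ.* s) ℚ.+ B ℚ.* X)
               (sym (fromℕ-next b h s b≤1)) (sym (fromℕ-+ b h)) ⟩
    excess h s ℚ.+ excess (b + h) s ℚ.+ B ℚ.* X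
      ∎
    where
    open ≡-Reasoning
    s C B H X : ℚ
    s = rescale 0 t
    C = fromℕ (pointsBelow h s)
    B = fromℕ b
    H = fromℕ h
    X = fromℕ 𝟙[ vdC h ◃? s ]
    identity : ∀ C B X H t →
      fromℕ 2 ℚ.* ((C ℚ.+ B ℚ.* X) ℚ.- (B ℚ.+ fromℕ 2 ℚ.* H) ℚ.* t) ≡
      (C ℚ.- H ℚ.* (fromℕ 2 ℚ.* t ℚ.- fromℕ 0)) ℚ.+
      ((C ℚ.+ B ℚ.* X) ℚ.- (B ℚ.+ H) ℚ.* (fromℕ 2 ℚ.* t ℚ.- fromℕ 0)) ℚ.+ B ℚ.* X
    identity = solve-∀ ℚ-ring

  excess-upper : ∀ b h t → b ≤ 1 → (∀ k → vdC (2 * k) ◃ t) →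
                 fromℕ 2 ℚ.* excess (b + 2 * h) t ≡
                 excess h (rescale 1 t) ℚ.+ excess (b + h) (rescale 1 t) ℚ.+ fromℕ b ℚ.* (1ℚ ℚ.- fromℕ 𝟙[ vdC h ◃? rescale 1 t ])
  excess-upper b h t b≤1 even-below = begin
    fromℕ 2 ℚ.* excess (b + 2 * h) t
      ≡⟨ cong₂ (λ c n → fromℕ 2 ℚ.* (c ℚ.- n ℚ.* t))
               (trans (cong fromℕ (pointsBelow-upper b h t b≤1 even-below)) (trans (fromℕ-+ (b + h) _) (cong (ℚ._+ C) (fromℕ-+ b h))))
               (fromℕ-b+2h b h) ⟩
    fromℕ 2 ℚ.* ((B ℚ.+ H ℚ.+ C) ℚ.- (B ℚ.+ fromℕ 2 ℚ.* H) ℚ.* t)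
      ≡⟨ identity C B X H t ⟩
    (C ℚ.- H ℚ.* s) ℚ.+ ((C ℚ.+ B ℚ.* X) ℚ.- (B ℚ.+ H) ℚ.* s) ℚ.+ B ℚ.* (1ℚ ℚ.- X)
      ≡⟨ cong₂ (λ c n → (C ℚ.- H ℚ.* s) ℚ.+ (c ℚ.- n ℚ.* s) ℚ.+ B ℚ.* (1ℚ ℚ.- X))
               (sym (fromℕ-next b h s b≤1)) (sym (fromℕ-+ b h)) ⟩
    excess h s ℚ.+ excess (b + h) s ℚ.+ B ℚ.* (1ℚ ℚ.- X)
      ∎
    where
    open ≡-Reasoning
    s C B H X : ℚ
    s = rescale 1 t
    C = fromℕ (pointsBelow h s)
    B = fromℕ b
    H = fromℕ h
    X = fromℕ 𝟙[ vdC h ◃? s ]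
    identity : ∀ C B X H t →
      fromℕ 2 ℚ.* ((B ℚ.+ H ℚ.+ C) ℚ.- (B ℚ.+ fromℕ 2 ℚ.* H) ℚ.* t) ≡
      (C ℚ.- H ℚ.* (fromℕ 2 ℚ.* t ℚ.- fromℕ 1)) ℚ.+
      ((C ℚ.+ B ℚ.* X) ℚ.- (B ℚ.+ H) ℚ.* (fromℕ 2 ℚ.* t ℚ.- fromℕ 1)) ℚ.+ B ℚ.* (1ℚ ℚ.- X)
    identity = solve-∀ ℚ-ring

-- Points in [0, t) (Open.pointsBelow is Defs.count vdC) and in [0, t].
module Open   = Counting ℚ._<?_ <-affine
module Closed = Counting ℚ._≤?_ ≤-affine

-- The upper bound on the excess

scaled-split : ∀ L e e₁ e₂ z → fromℕ 2 ℚ.* e ≡ e₁ ℚ.+ e₂ ℚ.+ z →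
               fromℕ (2 ^ suc L) ℚ.* e ≡ fromℕ (2 ^ L) ℚ.* e₁ ℚ.+ fromℕ (2 ^ L) ℚ.* e₂ ℚ.+ fromℕ (2 ^ L) ℚ.* z
scaled-split L e e₁ e₂ z 2e≡ = begin
  fromℕ (2 * 2 ^ L) ℚ.* e             ≡⟨ cong (ℚ._* e) (fromℕ-* 2 (2 ^ L)) ⟩
  fromℕ 2 ℚ.* P ℚ.* e                 ≡⟨ reassoc (fromℕ 2) P e ⟩
  P ℚ.* (fromℕ 2 ℚ.* e)               ≡⟨ cong (P ℚ.*_) 2e≡ ⟩
  P ℚ.* (e₁ ℚ.+ e₂ ℚ.+ z)             ≡⟨ distrib P e₁ e₂ z ⟩
  P ℚ.* e₁ ℚ.+ P ℚ.* e₂ ℚ.+ P ℚ.* z   ∎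
  where
  open ≡-Reasoning
  P : ℚ
  P = fromℕ (2 ^ L)
  reassoc : ∀ c p e → c ℚ.* p ℚ.* e ≡ p ℚ.* (c ℚ.* e)
  reassoc = solve-∀ ℚ-ring
  distrib : ∀ p x y z → p ℚ.* (x ℚ.+ y ℚ.+ z) ≡ p ℚ.* x ℚ.+ p ℚ.* y ℚ.+ p ℚ.* z
  distrib = solve-∀ ℚ-ring

fromℕ-Δ-split : ∀ L b h → b ≤ 1 →
                fromℕ (Δ (suc L) (b + 2 * h)) ≡ fromℕ (Δ L h) ℚ.+ fromℕ (Δ L (b + h)) ℚ.+ fromℕ (2 ^ L) ℚ.* fromℕ b
fromℕ-Δ-split L b h b≤1 = begin
  fromℕ (Δ (suc L) (b + 2 * h))                                 ≡⟨ cong fromℕ (Δ-split L b h b≤1) ⟩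
  fromℕ (Δ L h + Δ L (b + h) + 2 ^ L * b)                       ≡⟨ fromℕ-+ (Δ L h + Δ L (b + h)) (2 ^ L * b) ⟩
  fromℕ (Δ L h + Δ L (b + h)) ℚ.+ fromℕ (2 ^ L * b)             ≡⟨ cong₂ ℚ._+_ (fromℕ-+ (Δ L h) (Δ L (b + h))) (fromℕ-* (2 ^ L) b) ⟩
  fromℕ (Δ L h) ℚ.+ fromℕ (Δ L (b + h)) ℚ.+ fromℕ (2 ^ L) ℚ.* fromℕ b ∎
  where open ≡-Reasoning

ScaledBound : ℕ → ℕ → ℚ → Set
ScaledBound L n e = 0ℚ ℚ.≤ e × fromℕ (2 ^ L) ℚ.* e ℚ.≤ fromℕ (Δ L n)

scaledBound-split : ∀ L b h {e e₁ e₂ w} → b ≤ 1 → 0ℚ ℚ.≤ w → w ℚ.≤ 1ℚ →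
                    fromℕ 2 ℚ.* e ≡ e₁ ℚ.+ e₂ ℚ.+ fromℕ b ℚ.* w →
                    ScaledBound L h e₁ → ScaledBound L (b + h) e₂ → ScaledBound (suc L) (b + 2 * h) e
scaledBound-split L b h {e} {e₁} {e₂} {w} b≤1 0≤w w≤1 2e≡ (0≤e₁ , Pe₁≤) (0≤e₂ , Pe₂≤) = 0≤e , Pe≤
  where
  P : ℚ
  P = fromℕ (2 ^ L)
  0≤bw : 0ℚ ℚ.≤ fromℕ b ℚ.* w
  0≤bw = 0≤p*q (0≤fromℕ b) 0≤w
  0≤e : 0ℚ ℚ.≤ e
  0≤e = ℚₚ.*-cancelˡ-≤-pos (fromℕ 2) (subst (ℚ._≤ fromℕ 2 ℚ.* e) (ℚₚ.*-zeroʳ (fromℕ 2))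
          (subst (0ℚ ℚ.≤_) (sym 2e≡) (ℚₚ.+-mono-≤ (ℚₚ.+-mono-≤ 0≤e₁ 0≤e₂) 0≤bw)))
  Pbw≤Pb : P ℚ.* (fromℕ b ℚ.* w) ℚ.≤ P ℚ.* fromℕ b
  Pbw≤Pb = *-monoˡ-≤ (0≤fromℕ (2 ^ L))
             (subst (fromℕ b ℚ.* w ℚ.≤_) (ℚₚ.*-identityʳ (fromℕ b)) (*-monoˡ-≤ (0≤fromℕ b) w≤1))
  Pe≤ : fromℕ (2 ^ suc L) ℚ.* e ℚ.≤ fromℕ (Δ (suc L) (b + 2 * h))
  Pe≤ = subst₂ ℚ._≤_ (sym (scaled-split L e e₁ e₂ _ 2e≡)) (sym (fromℕ-Δ-split L b h b≤1))
          (ℚₚ.+-mono-≤ (ℚₚ.+-mono-≤ Pe₁≤ Pe₂≤) Pbw≤Pb)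

excess-scaledBound : ∀ L n t → n ≤ 2 ^ L → 0ℚ ℚ.≤ t → t ℚ.≤ 1ℚ → ScaledBound L n (Open.excess n t)
excess-scaledBound zero zero t _ _ _ =
  subst (ScaledBound 0 0) (sym (cong (ℚ._-_ 0ℚ) (ℚₚ.*-zeroˡ t))) (ℚₚ.≤-refl , ℚₚ.≤-refl)
excess-scaledBound zero (suc zero) t _ 0≤t t≤1 with vdC 0 ℚ.<? t
... | yes 0<t = subst (ScaledBound 0 1) (sym excess≡1-t)
                  (p≤q⇒0≤q-p t≤1 , subst (ℚ._≤ 1ℚ) (sym (ℚₚ.*-identityˡ (1ℚ ℚ.- t))) (0≤q⇒p-q≤p 0≤t))
  where
  excess≡1-t : Open.excess 1 t ≡ 1ℚ ℚ.- t
  excess≡1-t = cong₂ (λ c x → fromℕ c ℚ.- x) (𝟙-yes (vdC 0 ℚ.<? t) 0<t) (ℚₚ.*-identityˡ t)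
... | no 0≮t = subst (ScaledBound 0 1) (sym excess≡0) (ℚₚ.≤-refl , ℚₚ.<⇒≤ (ℚₚ.positive⁻¹ 1ℚ))
  where
  t≡0 : t ≡ 0ℚ
  t≡0 = ℚₚ.≤-antisym (ℚₚ.≮⇒≥ 0≮t) 0≤t
  excess≡0 : Open.excess 1 t ≡ 0ℚ
  excess≡0 = cong₂ (λ c x → fromℕ c ℚ.- fromℕ 1 ℚ.* x) (𝟙-no (vdC 0 ℚ.<? t) 0≮t) t≡0
excess-scaledBound zero (suc (suc _)) t (s≤s ()) _ _
excess-scaledBound (suc L) n t n≤2^L+1 0≤t t≤1 = by-halves (binarySplit n) n≤2^L+1 (t ℚ.≤? ½)
  where
  by-halves : ∀ {n} → BinarySplit n → n ≤ 2 ^ suc L → Dec (t ℚ.≤ ½) → ScaledBound (suc L) n (Open.excess n t)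
  by-halves (split b h b≤1) b+2h≤2^L+1 (yes t≤½) =
    scaledBound-split L b h b≤1 (0≤fromℕ 𝟙[ vdC h ℚ.<? s ]) (fromℕ-mono-≤ (𝟙≤1 (vdC h ℚ.<? s)))
      (Open.excess-lower b h t b≤1 odd-above)
      (excess-scaledBound L h s (b+2h≤2n⇒h≤n b h (2 ^ L) b≤1 b+2h≤2^L+1) 0≤s s≤1)
      (excess-scaledBound L (b + h) s (b+2h≤2n⇒b+h≤n b h (2 ^ L) b≤1 b+2h≤2^L+1) 0≤s s≤1)
    where
    s : ℚ
    s = rescale 0 t
    0≤s : 0ℚ ℚ.≤ s
    0≤s = proj₁ (rescale-bounds 0 t 0≤t t≤½)
    s≤1 : s ℚ.≤ 1ℚ
    s≤1 = proj₂ (rescale-bounds 0 t 0≤t t≤½)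
    odd-above : ∀ k → ¬ (vdC (1 + 2 * k) ℚ.< t)
    odd-above k = ≤⇒≮ (ℚₚ.≤-trans t≤½ (½≤vdC-odd k))
  by-halves (split b h b≤1) b+2h≤2^L+1 (no t≰½) =
    scaledBound-split L b h b≤1 (p≤q⇒0≤q-p (fromℕ-mono-≤ (𝟙≤1 (vdC h ℚ.<? s)))) (0≤q⇒p-q≤p (0≤fromℕ 𝟙[ vdC h ℚ.<? s ]))
      (Open.excess-upper b h t b≤1 even-below)
      (excess-scaledBound L h s (b+2h≤2n⇒h≤n b h (2 ^ L) b≤1 b+2h≤2^L+1) 0≤s s≤1)
      (excess-scaledBound L (b + h) s (b+2h≤2n⇒b+h≤n b h (2 ^ L) b≤1 b+2h≤2^L+1) 0≤s s≤1)
    where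
    s : ℚ
    s = rescale 1 t
    ½<t : ½ ℚ.< t
    ½<t = ℚₚ.≰⇒> t≰½
    0≤s : 0ℚ ℚ.≤ s
    0≤s = proj₁ (rescale-bounds 1 t (ℚₚ.<⇒≤ ½<t) t≤1)
    s≤1 : s ℚ.≤ 1ℚ
    s≤1 = proj₂ (rescale-bounds 1 t (ℚₚ.<⇒≤ ½<t) t≤1)
    even-below : ∀ k → vdC (2 * k) ℚ.< t
    even-below k = ℚₚ.<-trans (vdC-even<½ k) ½<t

-- Sharpness of the bound

exact-split : ∀ L b h {e e₁ e₂} → b ≤ 1 → fromℕ 2 ℚ.* e ≡ e₁ ℚ.+ e₂ ℚ.+ fromℕ b →
              fromℕ (2 ^ L) ℚ.* e₁ ≡ fromℕ (Δ L h) → fromℕ (2 ^ L) ℚ.* e₂ ≡ fromℕ (Δ L (b + h)) →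
              fromℕ (2 ^ suc L) ℚ.* e ≡ fromℕ (Δ (suc L) (b + 2 * h))
exact-split L b h {e} {e₁} {e₂} b≤1 2e≡ Pe₁≡ Pe₂≡ = begin
  fromℕ (2 ^ suc L) ℚ.* e                                          ≡⟨ scaled-split L e e₁ e₂ (fromℕ b) 2e≡ ⟩
  fromℕ (2 ^ L) ℚ.* e₁ ℚ.+ fromℕ (2 ^ L) ℚ.* e₂ ℚ.+ fromℕ (2 ^ L) ℚ.* fromℕ b
    ≡⟨ cong (ℚ._+ fromℕ (2 ^ L) ℚ.* fromℕ b) (cong₂ ℚ._+_ Pe₁≡ Pe₂≡) ⟩
  fromℕ (Δ L h) ℚ.+ fromℕ (Δ L (b + h)) ℚ.+ fromℕ (2 ^ L) ℚ.* fromℕ b ≡⟨ fromℕ-Δ-split L b h b≤1 ⟨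
  fromℕ (Δ (suc L) (b + 2 * h))                                     ∎
  where open ≡-Reasoning

b*w≡b : ∀ b {w} → b ≤ 1 → (b ≡ 1 → w ≡ 1ℚ) → fromℕ b ℚ.* w ≡ fromℕ b
b*w≡b zero          {w} _ _ = ℚₚ.*-zeroˡ w
b*w≡b (suc zero)    {w} _ w≡1 = trans (cong (ℚ._*_ 1ℚ) (w≡1 refl)) refl
b*w≡b (suc (suc _)) (s≤s ()) _

closed-excess-split-at-vdC : ∀ d r b h → d ≤ 1 → b ≤ 1 → (b ≡ 1 → h ≡ d + 2 * r) →
  fromℕ 2 ℚ.* Closed.excess (b + 2 * h) (vdC (d + 2 * r)) ≡
  Closed.excess h (vdC r) ℚ.+ Closed.excess (b + h) (vdC r) ℚ.+ fromℕ b
closed-excess-split-at-vdC zero r b h _ b≤1 h≡q =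
  trans (Closed.excess-lower b h t b≤1 odd-above)
        (cong₂ (λ s z → Closed.excess h s ℚ.+ Closed.excess (b + h) s ℚ.+ z) s≡vdC-r (b*w≡b b b≤1 χ≡1))
  where
  t : ℚ
  t = vdC (2 * r)
  s≡vdC-r : rescale 0 t ≡ vdC r
  s≡vdC-r = rescale-vdC 0 r z≤n
  odd-above : ∀ k → ¬ (vdC (1 + 2 * k) ℚ.≤ t)
  odd-above k = <⇒≱ (ℚₚ.<-≤-trans (vdC-even<½ r) (½≤vdC-odd k))
  χ≡1 : b ≡ 1 → fromℕ 𝟙[ vdC h ℚ.≤? rescale 0 t ] ≡ 1ℚ
  χ≡1 b≡1 = cong fromℕ (𝟙-yes (vdC h ℚ.≤? rescale 0 t)
    (subst₂ ℚ._≤_ (cong vdC (sym (h≡q b≡1))) (sym s≡vdC-r) (vdC-even≤vdC r)))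
closed-excess-split-at-vdC (suc zero) r b h _ b≤1 h≡q =
  trans (Closed.excess-upper b h t b≤1 even-below)
        (cong₂ (λ s z → Closed.excess h s ℚ.+ Closed.excess (b + h) s ℚ.+ z) s≡vdC-r (b*w≡b b b≤1 1-χ≡1))
  where
  t : ℚ
  t = vdC (1 + 2 * r)
  s≡vdC-r : rescale 1 t ≡ vdC r
  s≡vdC-r = rescale-vdC 1 r (s≤s z≤n)
  even-below : ∀ k → vdC (2 * k) ℚ.≤ t
  even-below k = ℚₚ.<⇒≤ (ℚₚ.<-≤-trans (vdC-even<½ k) (½≤vdC-odd r))
  1-χ≡1 : b ≡ 1 → 1ℚ ℚ.- fromℕ 𝟙[ vdC h ℚ.≤? rescale 1 t ] ≡ 1ℚ
  1-χ≡1 b≡1 = cong (λ c → 1ℚ ℚ.- fromℕ c) (𝟙-no (vdC h ℚ.≤? rescale 1 t)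
    (<⇒≱ (subst₂ ℚ._<_ (sym s≡vdC-r) (cong vdC (sym (h≡q b≡1))) (vdC<vdC-odd r))))
closed-excess-split-at-vdC (suc (suc _)) _ _ _ (s≤s ()) _ _

excess-exact : ∀ L q n → 2 * q ≤ n → n ≤ 2 * suc q → n ≤ 2 ^ L →
               fromℕ (2 ^ L) ℚ.* Closed.excess n (vdC q) ≡ fromℕ (Δ L n)
excess-exact zero zero          zero          _        _ _        = refl
excess-exact zero zero          (suc zero)    _        _ _        = refl
excess-exact zero (suc zero)    (suc zero)    (s≤s ()) _ _
excess-exact zero (suc (suc q)) (suc zero)    (s≤s ()) _ _
excess-exact zero _             (suc (suc _)) _        _ (s≤s ())
excess-exact (suc L) q n 2q≤n n≤2q+2 n≤2^L+1 = by-halves (binarySplit q) (binarySplit n) 2q≤n n≤2q+2 n≤2^L+1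
  where
  by-halves : ∀ {q n} → BinarySplit q → BinarySplit n → 2 * q ≤ n → n ≤ 2 * suc q → n ≤ 2 ^ suc L →
              fromℕ (2 ^ suc L) ℚ.* Closed.excess n (vdC q) ≡ fromℕ (Δ (suc L) n)
  by-halves (split d r d≤1) (split b h b≤1) 2q≤n n≤2q+2 n≤2^L+1 =
    exact-split L b h b≤1 (closed-excess-split-at-vdC d r b h d≤1 b≤1 h≡q)
      (excess-exact L r h 2r≤h (ℕₚ.≤-trans (ℕₚ.m≤n+m h b) b+h≤2r+2) (b+2h≤2n⇒h≤n b h (2 ^ L) b≤1 n≤2^L+1))
      (excess-exact L r (b + h) (ℕₚ.≤-trans 2r≤h (ℕₚ.m≤n+m h b)) b+h≤2r+2 (b+2h≤2n⇒b+h≤n b h (2 ^ L) b≤1 n≤2^L+1))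
    where
    q≤h : d + 2 * r ≤ h
    q≤h = 2q≤b+2h⇒q≤h b (d + 2 * r) h b≤1 2q≤n
    b+h≤1+q : b + h ≤ suc (d + 2 * r)
    b+h≤1+q = b+2h≤2n⇒b+h≤n b h (suc (d + 2 * r)) b≤1 n≤2q+2
    2r≤h : 2 * r ≤ h
    2r≤h = ℕₚ.≤-trans (ℕₚ.m≤n+m (2 * r) d) q≤h
    b+h≤2r+2 : b + h ≤ 2 * suc r
    b+h≤2r+2 = ℕₚ.≤-trans b+h≤1+q (1+d+2r≤2[1+r] d r d≤1)
    h≡q : b ≡ 1 → h ≡ d + 2 * r
    h≡q refl = ℕₚ.≤-antisym (ℕₚ.≤-pred b+h≤1+q) q≤h

closed-excess≤open-excess : ∀ n t δ → 0ℚ ℚ.< δ →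
                            Closed.excess n t ℚ.- fromℕ n ℚ.* δ ℚ.≤ Open.excess n (t ℚ.+ δ)
closed-excess≤open-excess n t δ 0<δ = begin
  Closed.excess n t ℚ.- fromℕ n ℚ.* δ                          ≡⟨ regroup (fromℕ (Closed.pointsBelow n t)) (fromℕ n) t δ ⟩
  fromℕ (Closed.pointsBelow n t) ℚ.- fromℕ n ℚ.* (t ℚ.+ δ)
    ≤⟨ ℚₚ.+-monoˡ-≤ (ℚ.- (fromℕ n ℚ.* (t ℚ.+ δ))) (fromℕ-mono-≤ closed≤open) ⟩
  Open.excess n (t ℚ.+ δ)                                      ∎
  where
  open ℚₚ.≤-Reasoning
  t<t+δ : t ℚ.< t ℚ.+ δ
  t<t+δ = subst (ℚ._< t ℚ.+ δ) (ℚₚ.+-identityʳ t) (ℚₚ.+-monoʳ-< t 0<δ)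
  closed≤open : Closed.pointsBelow n t ≤ Open.pointsBelow n (t ℚ.+ δ)
  closed≤open = sumℕ-mono-≤ n (λ k → 𝟙-mono (vdC k ℚ.≤? t) (vdC k ℚ.<? t ℚ.+ δ) (λ y≤t → ℚₚ.≤-<-trans y≤t t<t+δ))
  regroup : ∀ c m t δ → c ℚ.- m ℚ.* t ℚ.- m ℚ.* δ ≡ c ℚ.- m ℚ.* (t ℚ.+ δ)
  regroup = solve-∀ ℚ-ring

localDisc≡excess*recip : ∀ n t .{{_ : NonZero n}} → 0ℚ ℚ.≤ Open.excess n t →
                         localDisc vdC n t ≡ Open.excess n t ℚ.* recip n
localDisc≡excess*recip n t 0≤e = begin
  ℚ.∣ (+ C) ℚ./ n ℚ.- t ∣                           ≡⟨ cong (λ x → ℚ.∣ x ℚ.- t ∣) (/≡*recip (+ C) n) ⟩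
  ℚ.∣ fromℕ C ℚ.* recip n ℚ.- t ∣                   ≡⟨ cong (λ x → ℚ.∣ fromℕ C ℚ.* recip n ℚ.- x ∣) t≡[n*1/n]t ⟩
  ℚ.∣ fromℕ C ℚ.* recip n ℚ.- fromℕ n ℚ.* recip n ℚ.* t ∣ ≡⟨ cong ℚ.∣_∣ (distrib (fromℕ C) (fromℕ n) (recip n) t) ⟨
  ℚ.∣ Open.excess n t ℚ.* recip n ∣                 ≡⟨ ℚₚ.0≤p⇒∣p∣≡p (0≤p*q 0≤e (ℚₚ.<⇒≤ (0<recip n))) ⟩
  Open.excess n t ℚ.* recip n                       ∎
  where
  open ≡-Reasoning
  C : ℕ
  C = count vdC n t
  t≡[n*1/n]t : t ≡ fromℕ n ℚ.* recip n ℚ.* t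
  t≡[n*1/n]t = sym (trans (cong (ℚ._* t) (fromℕ*recip≡1 n)) (ℚₚ.*-identityˡ t))
  distrib : ∀ c m r t → (c ℚ.- m ℚ.* t) ℚ.* r ≡ c ℚ.* r ℚ.- m ℚ.* r ℚ.* t
  distrib = solve-∀ ℚ-ring

vdCDiscrepancy : ℕ → (n : ℕ) .{{_ : NonZero n}} → ℚ
vdCDiscrepancy L n = recip (2 ^ L) {{2^≢0 L}} ℚ.* (fromℕ (Δ L n) ℚ.* recip n)

localDisc-≤ : ∀ L n t .{{_ : NonZero n}} → n ≤ 2 ^ L → 0ℚ ℚ.≤ t → t ℚ.≤ 1ℚ →
              localDisc vdC n t ℚ.≤ vdCDiscrepancy L n
localDisc-≤ L n t n≤2^L 0≤t t≤1 = begin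
  localDisc vdC n t                         ≡⟨ localDisc≡excess*recip n t 0≤e ⟩
  e ℚ.* recip n                             ≡⟨ cong (ℚ._* recip n) (recip*[fromℕ*x]≡x (2 ^ L) e) ⟨
  recip (2 ^ L) ℚ.* (fromℕ (2 ^ L) ℚ.* e) ℚ.* recip n
    ≤⟨ *-monoʳ-≤ (ℚₚ.<⇒≤ (0<recip n)) (*-monoˡ-≤ (ℚₚ.<⇒≤ (0<recip (2 ^ L))) Pe≤Δ) ⟩
  recip (2 ^ L) ℚ.* fromℕ (Δ L n) ℚ.* recip n ≡⟨ ℚₚ.*-assoc (recip (2 ^ L)) (fromℕ (Δ L n)) (recip n) ⟩
  vdCDiscrepancy L n                        ∎
  where
  open ℚₚ.≤-Reasoning
  instance
    2^L≢0 : NonZero (2 ^ L)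
    2^L≢0 = 2^≢0 L
  e : ℚ
  e = Open.excess n t
  0≤e : 0ℚ ℚ.≤ e
  0≤e = proj₁ (excess-scaledBound L n t n≤2^L 0≤t t≤1)
  Pe≤Δ : fromℕ (2 ^ L) ℚ.* e ℚ.≤ fromℕ (Δ L n)
  Pe≤Δ = proj₂ (excess-scaledBound L n t n≤2^L 0≤t t≤1)

localDisc-approaches : ∀ L n .{{_ : NonZero n}} → n ≤ 2 ^ L → ∀ ε → 0ℚ ℚ.< ε →
                       ∃[ t ] (0ℚ ℚ.≤ t × t ℚ.≤ 1ℚ × vdCDiscrepancy L n ℚ.- ε ℚ.< localDisc vdC n t)
localDisc-approaches L n n≤2^L ε 0<ε = from-room (room-below-1 ε t₀ 0<ε (proj₂ (vdC-bounds q)))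
  where
  open ℚₚ.≤-Reasoning
  instance
    2^L≢0 : NonZero (2 ^ L)
    2^L≢0 = 2^≢0 L
  q : ℕ
  q = n / 2
  t₀ : ℚ
  t₀ = vdC q
  e₀ : ℚ
  e₀ = Closed.excess n t₀
  n≡ : n % 2 + 2 * q ≡ n
  n≡ = n%2+2*[n/2]≡n n
  exact : fromℕ (2 ^ L) ℚ.* e₀ ≡ fromℕ (Δ L n)
  exact = excess-exact L q n (subst (2 * q ≤_) n≡ (ℕₚ.m≤n+m (2 * q) (n % 2)))
            (subst (_≤ 2 * suc q) n≡ (ℕₚ.≤-trans (ℕₚ.n≤1+n _) (1+d+2r≤2[1+r] (n % 2) q (%2≤1 n)))) n≤2^L
  closed-value : vdCDiscrepancy L n ≡ e₀ ℚ.* recip n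
  closed-value = begin-equality
    recip (2 ^ L) ℚ.* (fromℕ (Δ L n) ℚ.* recip n)           ≡⟨ ℚₚ.*-assoc (recip (2 ^ L)) _ (recip n) ⟨
    recip (2 ^ L) ℚ.* fromℕ (Δ L n) ℚ.* recip n             ≡⟨ cong (λ x → recip (2 ^ L) ℚ.* x ℚ.* recip n) exact ⟨
    recip (2 ^ L) ℚ.* (fromℕ (2 ^ L) ℚ.* e₀) ℚ.* recip n    ≡⟨ cong (ℚ._* recip n) (recip*[fromℕ*x]≡x (2 ^ L) e₀) ⟩
    e₀ ℚ.* recip n                                          ∎
  distrib : ∀ e m r δ → (e ℚ.- m ℚ.* δ) ℚ.* r ≡ e ℚ.* r ℚ.- m ℚ.* r ℚ.* δ
  distrib = solve-∀ ℚ-ring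
  from-room : ∃[ δ ] (0ℚ ℚ.< δ × δ ℚ.< ε × t₀ ℚ.+ δ ℚ.≤ 1ℚ) →
              ∃[ t ] (0ℚ ℚ.≤ t × t ℚ.≤ 1ℚ × vdCDiscrepancy L n ℚ.- ε ℚ.< localDisc vdC n t)
  from-room (δ , 0<δ , δ<ε , t₀+δ≤1) = t₀ ℚ.+ δ , 0≤t₀+δ , t₀+δ≤1 , (begin-strict
    vdCDiscrepancy L n ℚ.- ε              <⟨ ℚₚ.+-monoʳ-< (vdCDiscrepancy L n) (ℚₚ.neg-antimono-< δ<ε) ⟩
    vdCDiscrepancy L n ℚ.- δ              ≡⟨ value-δ ⟩
    (e₀ ℚ.- fromℕ n ℚ.* δ) ℚ.* recip n    ≤⟨ *-monoʳ-≤ (ℚₚ.<⇒≤ (0<recip n)) (closed-excess≤open-excess n t₀ δ 0<δ) ⟩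
    Open.excess n (t₀ ℚ.+ δ) ℚ.* recip n  ≡⟨ localDisc≡excess*recip n (t₀ ℚ.+ δ) 0≤excess ⟨
    localDisc vdC n (t₀ ℚ.+ δ)            ∎)
    where
    0≤t₀+δ : 0ℚ ℚ.≤ t₀ ℚ.+ δ
    0≤t₀+δ = ℚₚ.+-mono-≤ (proj₁ (vdC-bounds q)) (ℚₚ.<⇒≤ 0<δ)
    0≤excess : 0ℚ ℚ.≤ Open.excess n (t₀ ℚ.+ δ)
    0≤excess = proj₁ (excess-scaledBound L n (t₀ ℚ.+ δ) n≤2^L 0≤t₀+δ t₀+δ≤1)
    value-δ : vdCDiscrepancy L n ℚ.- δ ≡ (e₀ ℚ.- fromℕ n ℚ.* δ) ℚ.* recip n
    value-δ = begin-equality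
      vdCDiscrepancy L n ℚ.- δ                       ≡⟨ cong (ℚ._-_ (vdCDiscrepancy L n)) (trans (cong (ℚ._* δ) (fromℕ*recip≡1 n)) (ℚₚ.*-identityˡ δ)) ⟨
      vdCDiscrepancy L n ℚ.- fromℕ n ℚ.* recip n ℚ.* δ ≡⟨ cong (ℚ._- fromℕ n ℚ.* recip n ℚ.* δ) closed-value ⟩
      e₀ ℚ.* recip n ℚ.- fromℕ n ℚ.* recip n ℚ.* δ   ≡⟨ distrib e₀ (fromℕ n) (recip n) δ ⟨
      (e₀ ℚ.- fromℕ n ℚ.* δ) ℚ.* recip n             ∎

mainTheorem3 : (n n1 : ℕ) .{{_ : NonZero n}} → 2 ^ n1 ≤ n → n < 2 ^ suc n1 →
    StarDiscrepancyIs vdC n (walshRHS n n1)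
mainTheorem3 n n1 _ n<2^L = subst (StarDiscrepancyIs vdC n) (sym (walshRHS≡Δ n n1))
  ( (λ t 0≤t t≤1 → localDisc-≤ (suc n1) n t n≤2^L 0≤t t≤1)
  , localDisc-approaches (suc n1) n n≤2^L )
  where
  n≤2^L : n ≤ 2 ^ suc n1
  n≤2^L = ℕₚ.<⇒≤ n<2^L
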